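{- For every integer $n\geq0$, \[ CP_{(2,2)}(n)=\frac{1}{(q;q)_{2n}}\sum_{r= -\infty}^\infty (-1)^r q^{3r^2} {2n\brack n-3r}_{q}. \]
   Context: $(a;q)_m=\prod_{j=0}^{m-1}(1-aq^j)$; for integers $a,b$, ${a\brack b}_q=\frac{(q;q)_a}{(q;q)_b(q;q)_{a-b}}$ if $0\le b\le a$ and $0$ otherwise. A cylindric partition with profile $(c_1,c_2)$ is a pair of partitions $(\lambda^{(1)},\lambda^{(2)})$ (parts weakly decreasing, $\lambda^{(i)}_j=0$ beyond the number of parts) with $\lambda^{(1)}_j\ge\lambda^{(2)}_{j+c_2}$ and $\lambda^{(2)}_j\ge\lambda^{(1)}_{j+c_1}$ for all $j\ge1$; its size is $|\lambda^{(1)}|+|\lambda^{(2)}|$. $CP_{(2,2)}(n)$ is the generating function $\sum q^{\text{size}}$ over cylindric partitions of profile $(2,2)$ in which each partition has at most $n$ parts, with $CP_{(2,2)}(0)=1$. -}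

module Defs where

open import Data.Nat as ℕ using (ℕ; zero; suc; _≤_; _≤?_; _∸_)
open import Data.Integer as ℤ using (ℤ; +_; -[1+_]; ∣_∣)
open import Data.Vec using (Vec; []; _∷_)
import Data.Vec as Vec
open import Data.Product using (_×_; _,_)
open import Relation.Nullary using (yes; no)

-- Formal power series in q with integer coefficients:
-- a series is its coefficient function (f N = coefficient of q^N).

PS : Set
PS = ℕ → ℤ

sumUpTo : ℕ → (ℕ → ℤ) → ℤ
sumUpTo zero    g = g zero
sumUpTo (suc N) g = sumUpTo N g ℤ.+ g (suc N)

_⊛_ : PS → PS → PS
(f ⊛ g) N = sumUpTo N (λ k → f k ℤ.* g (N ∸ k))

oneS : PS
oneS zero    = + 1
oneS (suc _) = + 0

qPow : ℕ → PS
qPow e N with e ℕ.≟ N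
... | yes _ = + 1
... | no  _ = + 0

oneMinusQ : ℕ → PS
oneMinusQ j N = oneS N ℤ.- qPow j N

qpoch : ℕ → PS
qpoch zero    = oneS
qpoch (suc m) = qpoch m ⊛ oneMinusQ (suc m)

-- Multiplicative inverse 1/f of a power series f with f 0 = 1:
-- c_0 = 1,  c_M = - Σ_{k=1}^{M} f k * c_{M-k}.
-- invUpTo f N is correct at all indices ≤ N.
invUpTo : PS → ℕ → PS
invUpTo f zero    = λ _ → + 1
invUpTo f (suc N) i with i ≤? N
... | yes _ = invUpTo f N i
... | no  _ = ℤ.- sumUpTo N (λ k → f (suc k) ℤ.* invUpTo f N (N ∸ k))

inv : PS → PS
inv f N = invUpTo f N N

qbin : ℕ → ℤ → PS
qbin a -[1+ _ ] N = + 0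
qbin a (+ b) N with b ≤? a
... | yes _ = (qpoch a ⊛ (inv (qpoch b) ⊛ inv (qpoch (a ∸ b)))) N
... | no  _ = + 0

negOnePow : ℕ → ℤ
negOnePow zero    = + 1
negOnePow (suc k) = ℤ.- negOnePow k

summand : ℕ → ℤ → PS
summand n r = λ N → negOnePow ∣ r ∣ ℤ.*
  (qPow (3 ℕ.* (∣ r ∣ ℕ.* ∣ r ∣)) ⊛ qbin (2 ℕ.* n) (+ n ℤ.- (+ 3) ℤ.* r)) N

-- Σ_{r=-∞}^{∞} summand n r, taken coefficientwise: the coefficient of q^N
-- only receives contributions from r with 3r^2 ≤ N, hence |r| ≤ N.
thetaSum : ℕ → PS
thetaSum n N = sumUpTo (2 ℕ.* N) (λ i → summand n (+ i ℤ.- + N) N)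

rhs : ℕ → PS
rhs n = inv (qpoch (2 ℕ.* n)) ⊛ thetaSum n

-- Cylindric partitions of profile (2,2) with at most n parts in each
-- partition. A partition with at most n parts is represented by the
-- vector (λ_1,…,λ_n) of its parts padded with zeros.

-- part j (0-based: at j the part λ_{j+1}); 0 beyond the vector
part : ∀ {n} → Vec ℕ n → ℕ → ℕ
part []       _       = 0
part (x ∷ xs) zero    = x
part (x ∷ xs) (suc j) = part xs j

IsPartition : ∀ {n} → Vec ℕ n → Set
IsPartition v = ∀ j → part v (suc j) ≤ part v j

IsCP22 : ∀ {n} → Vec ℕ n × Vec ℕ n → Set
IsCP22 (l1 , l2) =
  IsPartition l1 × IsPartition l2 ×
  (∀ j → part l2 (j ℕ.+ 2) ≤ part l1 j) ×
  (∀ j → part l1 (j ℕ.+ 2) ≤ part l2 j)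

size : ∀ {n} → Vec ℕ n × Vec ℕ n → ℕ
size (l1 , l2) = Vec.sum l1 ℕ.+ Vec.sum l2

{-# OPTIONS --safe #-}
-- Let W(p, m) be the generating function of the cylindric partitions of profile (2,2) whose two
-- partitions have at most p and m parts. Removing the first column of a pair with exactly p and m
-- parts leaves an arbitrary pair with at most p and m parts and size lowered by p + m, and exact
-- shapes force ∣p - m∣ ≤ 2; so the mixed difference Δ₂W(p, m) is q^{p+m} W(p, m) for ∣p - m∣ ≤ 2
-- and 0 otherwise, which determines W.
--
-- The sum Z(p, m) = Σ_r (-1)^r q^{3r²} / ((q;q)_{p-3r} (q;q)_{m+3r}) satisfies
-- (1 - q^{p+m}) Z(p, m) = Z(p-1, m) + Z(p, m-1) - Z(p-1, m-1) term by term, is symmetric, vanishes at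
-- m = -1 for p ≤ 2, and obeys Z(a+3, a) = Z(a+2, a) because the terms of the difference are
-- antisymmetric under r ↦ 1 - r. Hence Z, clamped to ∣p - m∣ ≤ 2, satisfies the recurrence of W and
-- equals it. Finally (q;q)_{2n} Z(n, n) is the theta sum of the right-hand side.
--
-- The cylindric partitions themselves are listed along the column decomposition, so that the length
-- of the list follows the recurrence.
module Submission where

open import Defs
open import Data.Nat as ℕ using (ℕ; zero; suc; _≤_; _<_; _≤′_; ≤′-refl; ≤′-step; z≤n; s≤s; _∸_; pred; _⊓_)
import Data.Nat.Properties as ℕP
import Data.Nat.Tactic.RingSolver as ℕSolver
open import Data.Integer as ℤ using (ℤ; +_; -[1+_]; ∣_∣)
import Data.Integer.Properties as ℤP
open import Data.Integer.Tactic.RingSolver using (solve-∀)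
open import Data.Vec as Vec using (Vec; []; _∷_; replicate)
open import Data.List using (List; []; _∷_; _++_; map; length)
import Data.List.Properties as ListP
open import Data.List.Relation.Unary.All using (All)
import Data.List.Relation.Unary.All as All
open import Data.List.Relation.Unary.Any using (here)
open import Data.List.Relation.Unary.AllPairs using ([]; _∷_)
open import Data.List.Relation.Unary.Unique.Propositional using (Unique)
import Data.List.Relation.Unary.Unique.Propositional.Properties as Unique
open import Data.List.Membership.Propositional using (_∈_)
open import Data.List.Membership.Propositional.Properties using (∈-++⁻; ∈-++⁺ˡ; ∈-++⁺ʳ; ∈-map⁻; ∈-map⁺)
open import Data.Product using (Σ; _×_; _,_; proj₁; proj₂; ∃; ∃₂)
open import Data.Sum using (inj₁; inj₂)
open import Data.Empty using (⊥-elim)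
open import Data.Maybe using (Maybe; just; nothing)
open import Function using (_⟨_⟩_; _∘_)
open import Relation.Nullary using (¬_; Dec; yes; no; _×-dec_)
open import Relation.Binary.PropositionalEquality
open import Relation.Binary.Definitions using (tri<; tri≈; tri>)
import Relation.Binary.Reasoning.Setoid
open import Algebra.Bundles using (CommutativeRing)
open import Algebra.Structures using (IsCommutativeRing)
open import Algebra.Solver.Ring.AlmostCommutativeRing using (AlmostCommutativeRing; fromCommutativeRing; _-Raw-AlmostCommutative⟶_)

sumUpTo-cong : ∀ N {g h : ℕ → ℤ} → (∀ k → k ≤ N → g k ≡ h k) → sumUpTo N g ≡ sumUpTo N h
sumUpTo-cong zero    g≡h = g≡h 0 z≤n
sumUpTo-cong (suc N) g≡h =
  cong₂ ℤ._+_ (sumUpTo-cong N (λ k k≤N → g≡h k (ℕP.m≤n⇒m≤1+n k≤N))) (g≡h (suc N) ℕP.≤-refl)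

sumUpTo-ext : ∀ N {g h : ℕ → ℤ} → (∀ k → g k ≡ h k) → sumUpTo N g ≡ sumUpTo N h
sumUpTo-ext N g≡h = sumUpTo-cong N (λ k _ → g≡h k)

sumUpTo-zero : ∀ N {g : ℕ → ℤ} → (∀ k → k ≤ N → g k ≡ + 0) → sumUpTo N g ≡ + 0
sumUpTo-zero N g≡0 = sumUpTo-cong N g≡0 ⟨ trans ⟩ sumUpTo-const0 N
  where
  sumUpTo-const0 : ∀ N → sumUpTo N (λ _ → + 0) ≡ + 0
  sumUpTo-const0 zero    = refl
  sumUpTo-const0 (suc N) = cong (ℤ._+ + 0) (sumUpTo-const0 N)

sumUpTo-+ : ∀ N (g h : ℕ → ℤ) → sumUpTo N (λ k → g k ℤ.+ h k) ≡ sumUpTo N g ℤ.+ sumUpTo N h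
sumUpTo-+ zero    g h = refl
sumUpTo-+ (suc N) g h = cong (ℤ._+ (g (suc N) ℤ.+ h (suc N))) (sumUpTo-+ N g h) ⟨ trans ⟩
  interchange (sumUpTo N g) (sumUpTo N h) (g (suc N)) (h (suc N))
  where
  interchange : ∀ a b c d → a ℤ.+ b ℤ.+ (c ℤ.+ d) ≡ a ℤ.+ c ℤ.+ (b ℤ.+ d)
  interchange = solve-∀

sumUpTo-neg : ∀ N (g : ℕ → ℤ) → sumUpTo N (λ k → ℤ.- g k) ≡ ℤ.- sumUpTo N g
sumUpTo-neg zero    g = refl
sumUpTo-neg (suc N) g = cong (ℤ._- g (suc N)) (sumUpTo-neg N g) ⟨ trans ⟩
  sym (ℤP.neg-distrib-+ (sumUpTo N g) (g (suc N)))

sumUpTo-*ˡ : ∀ N c (g : ℕ → ℤ) → c ℤ.* sumUpTo N g ≡ sumUpTo N (λ k → c ℤ.* g k)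
sumUpTo-*ˡ zero    c g = refl
sumUpTo-*ˡ (suc N) c g = ℤP.*-distribˡ-+ c (sumUpTo N g) (g (suc N)) ⟨ trans ⟩
  cong (ℤ._+ c ℤ.* g (suc N)) (sumUpTo-*ˡ N c g)

sumUpTo-*ʳ : ∀ N c (g : ℕ → ℤ) → sumUpTo N g ℤ.* c ≡ sumUpTo N (λ k → g k ℤ.* c)
sumUpTo-*ʳ N c g = ℤP.*-comm (sumUpTo N g) c ⟨ trans ⟩ sumUpTo-*ˡ N c g ⟨ trans ⟩
  sumUpTo-ext N (λ k → ℤP.*-comm c (g k))

sumUpTo-suc-first : ∀ N (g : ℕ → ℤ) → sumUpTo (suc N) g ≡ g 0 ℤ.+ sumUpTo N (λ k → g (suc k))
sumUpTo-suc-first zero    g = refl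
sumUpTo-suc-first (suc N) g = cong (ℤ._+ g (2 ℕ.+ N)) (sumUpTo-suc-first N g) ⟨ trans ⟩
  ℤP.+-assoc (g 0) _ _

sumUpTo-reverse : ∀ N (g : ℕ → ℤ) → sumUpTo N g ≡ sumUpTo N (λ k → g (N ∸ k))
sumUpTo-reverse zero    g = refl
sumUpTo-reverse (suc N) g = begin
  sumUpTo N g ℤ.+ g (suc N)                    ≡⟨ cong (ℤ._+ g (suc N)) (sumUpTo-reverse N g) ⟩
  sumUpTo N (λ k → g (N ∸ k)) ℤ.+ g (suc N)    ≡⟨ ℤP.+-comm _ (g (suc N)) ⟩
  g (suc N) ℤ.+ sumUpTo N (λ k → g (N ∸ k))    ≡⟨ sym (sumUpTo-suc-first N (λ k → g (suc N ∸ k))) ⟩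
  sumUpTo (suc N) (λ k → g (suc N ∸ k))        ∎
  where open ≡-Reasoning

sumUpTo-swap : ∀ A B (h : ℕ → ℕ → ℤ) →
  sumUpTo A (λ a → sumUpTo B (h a)) ≡ sumUpTo B (λ b → sumUpTo A (λ a → h a b))
sumUpTo-swap zero    B h = refl
sumUpTo-swap (suc A) B h = cong (ℤ._+ sumUpTo B (h (suc A))) (sumUpTo-swap A B h) ⟨ trans ⟩
  sym (sumUpTo-+ B (λ b → sumUpTo A (λ a → h a b)) (h (suc A)))

sumUpTo-triangle : ∀ N (G : ℕ → ℕ → ℤ) →
  sumUpTo N (λ k → sumUpTo k (λ j → G j (k ∸ j))) ≡ sumUpTo N (λ j → sumUpTo (N ∸ j) (G j))
sumUpTo-triangle zero    G = refl
sumUpTo-triangle (suc N) G = begin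
  sumUpTo N (λ k → sumUpTo k (λ j → G j (k ∸ j))) ℤ.+ (diagonal ℤ.+ G (suc N) (N ∸ N))
    ≡⟨ cong (ℤ._+ (diagonal ℤ.+ G (suc N) (N ∸ N))) (sumUpTo-triangle N G) ⟩
  sumUpTo N (λ j → sumUpTo (N ∸ j) (G j)) ℤ.+ (diagonal ℤ.+ G (suc N) (N ∸ N))
    ≡⟨ sym (ℤP.+-assoc (sumUpTo N (λ j → sumUpTo (N ∸ j) (G j))) diagonal (G (suc N) (N ∸ N))) ⟩
  sumUpTo N (λ j → sumUpTo (N ∸ j) (G j)) ℤ.+ diagonal ℤ.+ G (suc N) (N ∸ N)
    ≡⟨ cong₂ ℤ._+_ (sym (sumUpTo-+ N _ _) ⟨ trans ⟩ sumUpTo-cong N column-step) last-column ⟩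
  sumUpTo N (λ j → sumUpTo (suc N ∸ j) (G j)) ℤ.+ sumUpTo (suc N ∸ suc N) (G (suc N))
    ∎
  where
  open ≡-Reasoning
  diagonal = sumUpTo N (λ j → G j (suc N ∸ j))
  column-step : ∀ j → j ≤ N → sumUpTo (N ∸ j) (G j) ℤ.+ G j (suc N ∸ j) ≡ sumUpTo (suc N ∸ j) (G j)
  column-step j j≤N rewrite ℕP.+-∸-assoc 1 j≤N = refl
  last-column : G (suc N) (N ∸ N) ≡ sumUpTo (N ∸ N) (G (suc N))
  last-column rewrite ℕP.n∸n≡0 N = refl

qPow-diagonal : ∀ e → qPow e e ≡ + 1
qPow-diagonal e with e ℕ.≟ e
... | yes _  = refl
... | no e≢e = ⊥-elim (e≢e refl)

qPow-offDiagonal : ∀ {e k} → e ≢ k → qPow e k ≡ + 0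
qPow-offDiagonal {e} {k} e≢k with e ℕ.≟ k
... | yes e≡k = ⊥-elim (e≢k e≡k)
... | no _    = refl

sumUpTo-qPow-out : ∀ N e (a : ℕ → ℤ) → N < e → sumUpTo N (λ k → qPow e k ℤ.* a k) ≡ + 0
sumUpTo-qPow-out N e a N<e = sumUpTo-zero N λ k k≤N →
  cong (ℤ._* a k) (qPow-offDiagonal λ e≡k → ℕP.<⇒≱ N<e (subst (_≤ N) (sym e≡k) k≤N))

sumUpTo-qPow-in : ∀ N e (a : ℕ → ℤ) → e ≤ N → sumUpTo N (λ k → qPow e k ℤ.* a k) ≡ a e
sumUpTo-qPow-in zero .zero a z≤n = cong (ℤ._* a 0) (qPow-diagonal 0) ⟨ trans ⟩ ℤP.*-identityˡ (a 0)
sumUpTo-qPow-in (suc N) e a e≤1+N with ℕP.m≤n⇒m<n∨m≡n e≤1+N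
... | inj₁ e<1+N = cong₂ ℤ._+_ (sumUpTo-qPow-in N e a (ℕP.≤-pred e<1+N))
                              (cong (ℤ._* a (suc N)) (qPow-offDiagonal (ℕP.<⇒≢ e<1+N)))
                   ⟨ trans ⟩ ℤP.+-identityʳ (a e)
... | inj₂ refl  = cong₂ ℤ._+_ (sumUpTo-qPow-out N (suc N) a ℕP.≤-refl)
                              (cong (ℤ._* a (suc N)) (qPow-diagonal (suc N)))
                   ⟨ trans ⟩ ℤP.+-identityˡ _ ⟨ trans ⟩ ℤP.*-identityˡ (a (suc N))

-- The ring of power series

infix 4 _≋_
_≋_ : PS → PS → Set
f ≋ g = ∀ N → f N ≡ g N

infixl 6 _⊕_ _⊖_
infix 8 ⊝_
_⊕_ : PS → PS → PS
(f ⊕ g) N = f N ℤ.+ g N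

⊝_ : PS → PS
(⊝ f) N = ℤ.- f N

_⊖_ : PS → PS → PS
f ⊖ g = f ⊕ ⊝ g

zeroS : PS
zeroS _ = + 0

≋-sym : ∀ {f g} → f ≋ g → g ≋ f
≋-sym f≋g N = sym (f≋g N)

≋-trans : ∀ {f g h} → f ≋ g → g ≋ h → f ≋ h
≋-trans f≋g g≋h N = trans (f≋g N) (g≋h N)

⊛-cong : ∀ {f f′ g g′} → f ≋ f′ → g ≋ g′ → f ⊛ g ≋ f′ ⊛ g′
⊛-cong f≋f′ g≋g′ N = sumUpTo-ext N (λ k → cong₂ ℤ._*_ (f≋f′ k) (g≋g′ (N ∸ k)))

⊛-comm : ∀ f g → f ⊛ g ≋ g ⊛ f
⊛-comm f g N = sumUpTo-reverse N _ ⟨ trans ⟩ sumUpTo-cong N λ k k≤N →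
  cong (λ i → f (N ∸ k) ℤ.* g i) (ℕP.m∸[m∸n]≡n k≤N) ⟨ trans ⟩ ℤP.*-comm (f (N ∸ k)) (g k)

⊛-assoc : ∀ f g h → (f ⊛ g) ⊛ h ≋ f ⊛ (g ⊛ h)
⊛-assoc f g h N = begin
  sumUpTo N (λ k → sumUpTo k (λ j → f j ℤ.* g (k ∸ j)) ℤ.* h (N ∸ k))
    ≡⟨ sumUpTo-ext N (λ k → sumUpTo-*ʳ k (h (N ∸ k)) _) ⟩
  sumUpTo N (λ k → sumUpTo k (λ j → f j ℤ.* g (k ∸ j) ℤ.* h (N ∸ k)))
    ≡⟨ sumUpTo-ext N (λ k → sumUpTo-cong k λ j j≤k →
         cong (λ i → f j ℤ.* g (k ∸ j) ℤ.* h (N ∸ i)) (sym (ℕP.m+[n∸m]≡n j≤k))) ⟩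
  sumUpTo N (λ k → sumUpTo k (λ j → G j (k ∸ j)))
    ≡⟨ sumUpTo-triangle N G ⟩
  sumUpTo N (λ j → sumUpTo (N ∸ j) (G j))
    ≡⟨ sumUpTo-ext N (λ j → sumUpTo-ext (N ∸ j) λ i →
         ℤP.*-assoc (f j) (g i) _ ⟨ trans ⟩ cong (λ l → f j ℤ.* (g i ℤ.* h l)) (sym (ℕP.∸-+-assoc N j i))) ⟩
  sumUpTo N (λ j → sumUpTo (N ∸ j) (λ i → f j ℤ.* (g i ℤ.* h (N ∸ j ∸ i))))
    ≡⟨ sumUpTo-ext N (λ j → sym (sumUpTo-*ˡ (N ∸ j) (f j) _)) ⟩
  sumUpTo N (λ j → f j ℤ.* sumUpTo (N ∸ j) (λ i → g i ℤ.* h (N ∸ j ∸ i)))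
    ∎
  where
  open ≡-Reasoning
  G : ℕ → ℕ → ℤ
  G j i = f j ℤ.* g i ℤ.* h (N ∸ (j ℕ.+ i))

⊛-distribˡ : ∀ f g h → f ⊛ (g ⊕ h) ≋ f ⊛ g ⊕ f ⊛ h
⊛-distribˡ f g h N =
  sumUpTo-ext N (λ k → ℤP.*-distribˡ-+ (f k) (g (N ∸ k)) (h (N ∸ k))) ⟨ trans ⟩ sumUpTo-+ N _ _

qPow-⊛-in : ∀ e f N → e ≤ N → (qPow e ⊛ f) N ≡ f (N ∸ e)
qPow-⊛-in e f N = sumUpTo-qPow-in N e (λ k → f (N ∸ k))

qPow-⊛-out : ∀ e f N → N < e → (qPow e ⊛ f) N ≡ + 0
qPow-⊛-out e f N = sumUpTo-qPow-out N e (λ k → f (N ∸ k))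

oneS≋qPow0 : oneS ≋ qPow 0
oneS≋qPow0 zero    = refl
oneS≋qPow0 (suc N) = refl

⊛-identityˡ : ∀ f → oneS ⊛ f ≋ f
⊛-identityˡ f N = ⊛-cong {g = f} oneS≋qPow0 (λ _ → refl) N ⟨ trans ⟩ qPow-⊛-in 0 f N z≤n

PS-isCommutativeRing : IsCommutativeRing _≋_ _⊕_ _⊛_ ⊝_ zeroS oneS
PS-isCommutativeRing = record
  { isRing = record
    { +-isAbelianGroup = record
      { isGroup = record
        { isMonoid = record
          { isSemigroup = record
            { isMagma = record
              { isEquivalence = record { refl = λ _ → refl ; sym = ≋-sym ; trans = ≋-trans }
              ; ∙-cong = λ f≋f′ g≋g′ N → cong₂ ℤ._+_ (f≋f′ N) (g≋g′ N) }
            ; assoc = λ f g h N → ℤP.+-assoc (f N) (g N) (h N) }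
          ; identity = (λ f N → ℤP.+-identityˡ (f N)) , (λ f N → ℤP.+-identityʳ (f N)) }
        ; inverse = (λ f N → ℤP.+-inverseˡ (f N)) , (λ f N → ℤP.+-inverseʳ (f N))
        ; ⁻¹-cong = λ f≋f′ N → cong ℤ.-_ (f≋f′ N) }
      ; comm = λ f g N → ℤP.+-comm (f N) (g N) }
    ; *-cong = ⊛-cong
    ; *-assoc = ⊛-assoc
    ; *-identity = ⊛-identityˡ , (λ f → ≋-trans (⊛-comm f oneS) (⊛-identityˡ f))
    ; distrib = ⊛-distribˡ , (λ f g h → ≋-trans (⊛-comm (g ⊕ h) f) (≋-trans (⊛-distribˡ f g h)
                                (λ N → cong₂ ℤ._+_ (⊛-comm f g N) (⊛-comm f h N)))) }
  ; *-comm = ⊛-comm }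

PS-commutativeRing : CommutativeRing _ _
PS-commutativeRing = record { isCommutativeRing = PS-isCommutativeRing }

PS-ring : AlmostCommutativeRing _ _
PS-ring = fromCommutativeRing PS-commutativeRing

-- The ring solver for power series takes integer coefficients through `scalar`; with these,
-- the two normal forms of every identity used below agree definitionally, so `λ _ → refl` closes it.
scalar : ℤ → PS
scalar c N = c ℤ.* oneS N

scalar-* : ∀ c d → scalar (c ℤ.* d) ≋ scalar c ⊛ scalar d
scalar-* c d N = sym (begin
  (scalar c ⊛ scalar d) N                 ≡⟨ sumUpTo-ext N (λ k → cong (ℤ._* scalar d (N ∸ k)) (ℤP.*-comm c (oneS k))) ⟩
  sumUpTo N (λ k → oneS k ℤ.* c ℤ.* scalar d (N ∸ k))
                                          ≡⟨ sumUpTo-ext N (λ k → ℤP.*-assoc (oneS k) c _) ⟩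
  (oneS ⊛ (λ k → c ℤ.* scalar d k)) N     ≡⟨ ⊛-identityˡ (λ k → c ℤ.* scalar d k) N ⟩
  c ℤ.* (d ℤ.* oneS N)                    ≡⟨ sym (ℤP.*-assoc c d (oneS N)) ⟩
  scalar (c ℤ.* d) N                      ∎)
  where open ≡-Reasoning

scalar-morphism : CommutativeRing.rawRing ℤP.+-*-commutativeRing -Raw-AlmostCommutative⟶ PS-ring
scalar-morphism = record
  { ⟦_⟧    = scalar
  ; +-homo = λ c d N → ℤP.*-distribʳ-+ (oneS N) c d
  ; *-homo = scalar-*
  ; -‿homo = λ c N → sym (ℤP.neg-distribˡ-* c (oneS N))
  ; 0-homo = λ N → ℤP.*-zeroˡ (oneS N)
  ; 1-homo = λ N → ℤP.*-identityˡ (oneS N) }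

scalar-≟ : ∀ c d → Maybe (scalar c ≋ scalar d)
scalar-≟ c d with c ℤ.≟ d
... | yes refl = just (λ _ → refl)
... | no _     = nothing

open import Algebra.Solver.Ring _ PS-ring scalar-morphism scalar-≟ using (solve; _:+_; _:*_; _:-_; _:=_)

open CommutativeRing PS-commutativeRing
  using ()
  renaming (setoid to PS-setoid; refl to ≋-refl; +-cong to ⊕-cong; -‿cong to ⊝-cong;
            zeroˡ to ⊛-zeroˡ; zeroʳ to ⊛-zeroʳ; *-identityʳ to ⊛-identityʳ)

≋-reflexive : ∀ {f g} → f ≡ g → f ≋ g
≋-reflexive refl _ = refl

⊛-congˡ : ∀ f {g g′} → g ≋ g′ → f ⊛ g ≋ f ⊛ g′
⊛-congˡ f = ⊛-cong {f} {f} (λ _ → refl)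

⊛-congʳ : ∀ g {f f′} → f ≋ f′ → f ⊛ g ≋ f′ ⊛ g
⊛-congʳ g f≋f′ = ⊛-cong {g = g} {g} f≋f′ (λ _ → refl)

⊕-congˡ : ∀ f {g g′} → g ≋ g′ → f ⊕ g ≋ f ⊕ g′
⊕-congˡ f g≋g′ N = cong (ℤ._+_ (f N)) (g≋g′ N)

⊖-zero : ∀ f {g} → g ≋ zeroS → f ⊖ g ≋ f
⊖-zero f g≋0 N = cong (ℤ._-_ (f N)) (g≋0 N) ⟨ trans ⟩ ℤP.+-identityʳ (f N)

⊛-zero-inner : ∀ f g {h} → h ≋ zeroS → f ⊛ (g ⊛ h) ≋ zeroS
⊛-zero-inner f g h≋0 = ≋-trans (⊛-congˡ f (≋-trans (⊛-congˡ g h≋0) (⊛-zeroʳ g))) (⊛-zeroʳ f)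

module ≋-Reasoning = Relation.Binary.Reasoning.Setoid PS-setoid

scalar-⊛ : ∀ c f N → (scalar c ⊛ f) N ≡ c ℤ.* f N
scalar-⊛ c f N =
  sumUpTo-ext N (λ k → swap-c c (oneS k) (f (N ∸ k))) ⟨ trans ⟩ ⊛-identityˡ (λ k → c ℤ.* f k) N
  where
  swap-c : ∀ a b d → a ℤ.* b ℤ.* d ≡ b ℤ.* (a ℤ.* d)
  swap-c = solve-∀

scalar-neg-⊛ : ∀ c f → scalar (ℤ.- c) ⊛ f ≋ ⊝ (scalar c ⊛ f)
scalar-neg-⊛ c f N =
  scalar-⊛ (ℤ.- c) f N ⟨ trans ⟩ sym (ℤP.neg-distribˡ-* c (f N)) ⟨ trans ⟩ cong ℤ.-_ (sym (scalar-⊛ c f N))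

qPow-+ : ∀ a b → qPow a ⊛ qPow b ≋ qPow (a ℕ.+ b)
qPow-+ a b N with a ℕ.≤? N
... | no a≰N  = qPow-⊛-out a (qPow b) N (ℕP.≰⇒> a≰N) ⟨ trans ⟩
                sym (qPow-offDiagonal λ a+b≡N → a≰N (subst (a ≤_) a+b≡N (ℕP.m≤m+n a b)))
... | yes a≤N = qPow-⊛-in a (qPow b) N a≤N ⟨ trans ⟩ shift (b ℕ.≟ N ∸ a)
  where
  shift : Dec (b ≡ N ∸ a) → qPow b (N ∸ a) ≡ qPow (a ℕ.+ b) N
  shift (yes refl) rewrite ℕP.m+[n∸m]≡n a≤N = qPow-diagonal (N ∸ a) ⟨ trans ⟩ sym (qPow-diagonal N)
  shift (no b≢N∸a) = qPow-offDiagonal b≢N∸a ⟨ trans ⟩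
    sym (qPow-offDiagonal λ a+b≡N → b≢N∸a (sym (ℕP.m+n∸m≡n a b) ⟨ trans ⟩ cong (_∸ a) a+b≡N))

invUpTo-inv : ∀ f N i → i ≤ N → invUpTo f N i ≡ inv f i
invUpTo-inv f N i i≤N with ℕP.m≤n⇒m<n∨m≡n i≤N
... | inj₂ refl = refl
invUpTo-inv f (suc N) i i≤N | inj₁ i<1+N with i ℕ.≤? N
... | yes i≤N′ = invUpTo-inv f N i i≤N′
... | no i≰N   = ⊥-elim (i≰N (ℕP.≤-pred i<1+N))

inv-suc : ∀ f N → inv f (suc N) ≡ ℤ.- sumUpTo N (λ k → f (suc k) ℤ.* inv f (N ∸ k))
inv-suc f N with suc N ℕ.≤? N
... | yes 1+N≤N = ⊥-elim (ℕP.n≮n N 1+N≤N)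
... | no _      = cong ℤ.-_ (sumUpTo-cong N λ k _ →
                    cong (f (suc k) ℤ.*_) (invUpTo-inv f N (N ∸ k) (ℕP.m∸n≤m N k)))

⊛-inverseʳ : ∀ f → f 0 ≡ + 1 → f ⊛ inv f ≋ oneS
⊛-inverseʳ f f0≡1 zero rewrite f0≡1 = refl
⊛-inverseʳ f f0≡1 (suc N) = begin
  sumUpTo (suc N) (λ k → f k ℤ.* inv f (suc N ∸ k)) ≡⟨ sumUpTo-suc-first N _ ⟩
  f 0 ℤ.* inv f (suc N) ℤ.+ S                        ≡⟨ cong₂ (λ a b → a ℤ.* b ℤ.+ S) f0≡1 (inv-suc f N) ⟩
  + 1 ℤ.* (ℤ.- S) ℤ.+ S                              ≡⟨ cancel S ⟩
  + 0                                                ∎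
  where
  open ≡-Reasoning
  S = sumUpTo N (λ k → f (suc k) ℤ.* inv f (N ∸ k))
  cancel : ∀ x → + 1 ℤ.* (ℤ.- x) ℤ.+ x ≡ + 0
  cancel = solve-∀

qpoch-0 : ∀ m → qpoch m 0 ≡ + 1
qpoch-0 zero    = refl
qpoch-0 (suc m) rewrite qpoch-0 m = refl

sumRange : ℕ → ℕ → (ℤ → ℤ) → ℤ
sumRange K L F = sumUpTo (K ℕ.+ L) (λ i → F (+ i ℤ.- + K))

sumRangeS : ℕ → ℕ → (ℤ → PS) → PS
sumRangeS K L F N = sumRange K L (λ r → F r N)

sumRange-ext : ∀ K L {F G : ℤ → ℤ} → (∀ r → F r ≡ G r) → sumRange K L F ≡ sumRange K L G
sumRange-ext K L F≡G = sumUpTo-ext (K ℕ.+ L) (λ i → F≡G _)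

sumRange-extendˡ : ∀ K L F → sumRange (suc K) L F ≡ F -[1+ K ] ℤ.+ sumRange K L F
sumRange-extendˡ K L F = sumUpTo-suc-first (K ℕ.+ L) _ ⟨ trans ⟩
  cong (λ s → F -[1+ K ] ℤ.+ s) (sumUpTo-ext (K ℕ.+ L) λ i → cong F (shift i))
  where
  shift : ∀ i → + suc i ℤ.- + suc K ≡ + i ℤ.- + K
  shift i = ℤP.m-n≡m⊖n (suc i) (suc K) ⟨ trans ⟩ ℤP.[1+m]⊖[1+n]≡m⊖n i K ⟨ trans ⟩ sym (ℤP.m-n≡m⊖n i K)

sumRange-extendʳ : ∀ K L F → sumRange K (suc L) F ≡ sumRange K L F ℤ.+ F (+ suc L)
sumRange-extendʳ K L F rewrite ℕP.+-suc K L = cong (λ r → sumRange K L F ℤ.+ F r) last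
  where
  cancel : ∀ k l → k ℤ.+ l ℤ.- k ≡ l
  cancel = solve-∀
  last : + suc (K ℕ.+ L) ℤ.- + K ≡ + suc L
  last = cong (λ k → + k ℤ.- + K) (sym (ℕP.+-suc K L)) ⟨ trans ⟩
         cong (ℤ._- + K) (ℤP.pos-+ K (suc L)) ⟨ trans ⟩ cancel (+ K) (+ suc L)

sumRange-shrinkˡ : ∀ {K₀ K} L F → K₀ ≤′ K → (∀ k → K₀ ≤ k → F -[1+ k ] ≡ + 0) →
  sumRange K L F ≡ sumRange K₀ L F
sumRange-shrinkˡ L F ≤′-refl              _      = refl
sumRange-shrinkˡ L F (≤′-step {K} K₀≤′K) vanish =
  sumRange-extendˡ K L F ⟨ trans ⟩ cong (ℤ._+ sumRange K L F) (vanish K (ℕP.≤′⇒≤ K₀≤′K)) ⟨ trans ⟩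
  ℤP.+-identityˡ _ ⟨ trans ⟩ sumRange-shrinkˡ L F K₀≤′K vanish

sumRange-shrinkʳ : ∀ {L₀ L} K F → L₀ ≤′ L → (∀ l → L₀ < l → F (+ l) ≡ + 0) →
  sumRange K L F ≡ sumRange K L₀ F
sumRange-shrinkʳ K F ≤′-refl              _      = refl
sumRange-shrinkʳ K F (≤′-step {L} L₀≤′L) vanish =
  sumRange-extendʳ K L F ⟨ trans ⟩ cong (ℤ._+_ (sumRange K L F)) (vanish (suc L) (s≤s (ℕP.≤′⇒≤ L₀≤′L))) ⟨ trans ⟩
  ℤP.+-identityʳ _ ⟨ trans ⟩ sumRange-shrinkʳ K F L₀≤′L vanish

sumRange-shrink : ∀ {K₀ L₀ K L} F → K₀ ≤ K → L₀ ≤ L →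
  (∀ k → K₀ ≤ k → F -[1+ k ] ≡ + 0) → (∀ l → L₀ < l → F (+ l) ≡ + 0) →
  sumRange K L F ≡ sumRange K₀ L₀ F
sumRange-shrink {K₀} {L = L} F K₀≤K L₀≤L vanishˡ vanishʳ =
  sumRange-shrinkˡ L F (ℕP.≤⇒≤′ K₀≤K) vanishˡ ⟨ trans ⟩ sumRange-shrinkʳ K₀ F (ℕP.≤⇒≤′ L₀≤L) vanishʳ

sumRange-+ : ∀ K L F G → sumRange K L (λ r → F r ℤ.+ G r) ≡ sumRange K L F ℤ.+ sumRange K L G
sumRange-+ K L F G = sumUpTo-+ (K ℕ.+ L) _ _

sumRange-neg : ∀ K L F → sumRange K L (λ r → ℤ.- F r) ≡ ℤ.- sumRange K L F
sumRange-neg K L F = sumUpTo-neg (K ℕ.+ L) _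

sumRange-reflect : ∀ K L F → sumRange K L F ≡ sumRange K L (λ r → F (+ L ℤ.- + K ℤ.- r))
sumRange-reflect K L F = sumUpTo-reverse (K ℕ.+ L) _ ⟨ trans ⟩ sumUpTo-cong (K ℕ.+ L) λ i i≤K+L →
  cong F (reflected-index i i≤K+L)
  where
  rearrange : ∀ k l i → k ℤ.+ l ℤ.- i ℤ.- k ≡ l ℤ.- k ℤ.- (i ℤ.- k)
  rearrange = solve-∀
  reflected-index : ∀ i → i ≤ K ℕ.+ L → + (K ℕ.+ L ∸ i) ℤ.- + K ≡ + L ℤ.- + K ℤ.- (+ i ℤ.- + K)
  reflected-index i i≤K+L =
    cong (ℤ._- + K) (sym (ℤP.⊖-≥ i≤K+L) ⟨ trans ⟩ sym (ℤP.m-n≡m⊖n (K ℕ.+ L) i) ⟨ trans ⟩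
                     cong (ℤ._- + i) (ℤP.pos-+ K L)) ⟨ trans ⟩
    rearrange (+ K) (+ L) (+ i)

⊛-sumRangeS : ∀ K L g F → g ⊛ sumRangeS K L F ≋ sumRangeS K L (λ r → g ⊛ F r)
⊛-sumRangeS K L g F N =
  sumUpTo-ext N (λ k → sumUpTo-*ˡ (K ℕ.+ L) (g k) _) ⟨ trans ⟩ sumUpTo-swap N (K ℕ.+ L) _

sumRangeS-⊕ : ∀ K L F G → sumRangeS K L (λ r → F r ⊕ G r) ≋ sumRangeS K L F ⊕ sumRangeS K L G
sumRangeS-⊕ K L F G N = sumRange-+ K L (λ r → F r N) (λ r → G r N)

sumRangeS-⊝ : ∀ K L F → sumRangeS K L (λ r → ⊝ F r) ≋ ⊝ sumRangeS K L F
sumRangeS-⊝ K L F N = sumRange-neg K L (λ r → F r N)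

sumRangeS-cong : ∀ K L {F G} → (∀ r → F r ≋ G r) → sumRangeS K L F ≋ sumRangeS K L G
sumRangeS-cong K L F≋G N = sumRange-ext K L (λ r → F≋G r N)

sumRange-antisymmetric : ∀ K F → (∀ r → F (+ 1 ℤ.- r) ≡ ℤ.- F r) → sumRange K (suc K) F ≡ + 0
sumRange-antisymmetric K F antisym = x≡-x⇒x≡0 (sumRange-reflect K (suc K) F ⟨ trans ⟩
  sumRange-ext K (suc K) (λ r → cong F (reflection r) ⟨ trans ⟩ antisym r) ⟨ trans ⟩ sumRange-neg K (suc K) F)
  where
  rearrange : ∀ k r → + 1 ℤ.+ k ℤ.- k ℤ.- r ≡ + 1 ℤ.- r
  rearrange = solve-∀
  reflection : ∀ r → + suc K ℤ.- + K ℤ.- r ≡ + 1 ℤ.- r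
  reflection = rearrange (+ K)
  x≡-x⇒x≡0 : ∀ {x} → x ≡ ℤ.- x → x ≡ + 0
  x≡-x⇒x≡0 {+ zero}   _  = refl
  x≡-x⇒x≡0 {+ suc _}  ()
  x≡-x⇒x≡0 { -[1+ _ ]} ()

sumRange-symmetric : ∀ K F → sumRange K K F ≡ sumRange K K (λ r → F (ℤ.- r))
sumRange-symmetric K F = sumRange-reflect K K F ⟨ trans ⟩ sumRange-ext K K (λ r → cong F (cancel (+ K) r))
  where
  cancel : ∀ k r → k ℤ.- k ℤ.- r ≡ ℤ.- r
  cancel = solve-∀

-- The sums Z(p, m)

invPoch : ℤ → PS
invPoch (+ k)    = inv (qpoch k)
invPoch -[1+ _ ] = zeroS

sign : ℤ → ℤ
sign r = negOnePow ∣ r ∣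

exponent : ℤ → ℕ
exponent r = 3 ℕ.* (∣ r ∣ ℕ.* ∣ r ∣)

weight : ℤ → PS
weight r = scalar (sign r) ⊛ qPow (exponent r)

thetaTerm : ℤ → ℤ → ℤ → PS
thetaTerm p m r = weight r ⊛ (invPoch (p ℤ.- + 3 ℤ.* r) ⊛ invPoch (m ℤ.+ + 3 ℤ.* r))

-- Z p m = Σ_r (-1)^r q^{3r²} / ((q;q)_{p-3r} (q;q)_{m+3r}); only -∣m∣ ≤ r ≤ ∣p∣ contribute.
Z : ℤ → ℤ → PS
Z p m = sumRangeS ∣ m ∣ ∣ p ∣ (thetaTerm p m)

oneMinus-⊛ : ∀ u v → (oneS ⊖ u) ⊛ v ≋ v ⊖ u ⊛ v
oneMinus-⊛ u v = ≋-trans (distribute oneS u v) (⊕-cong (⊛-identityˡ v) ≋-refl)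
  where
  distribute : ∀ o u v → (o ⊖ u) ⊛ v ≋ o ⊛ v ⊖ u ⊛ v
  distribute = solve 3 (λ o u v → (o :- u) :* v := o :* v :- u :* v) (λ _ → refl)

invPoch-pred : ∀ z → invPoch (z ℤ.- + 1) ≋ invPoch z ⊖ qPow ∣ z ∣ ⊛ invPoch z
invPoch-pred -[1+ k ]  N = sym (cong (λ x → + 0 ℤ.- x) (⊛-zeroʳ (qPow (suc k)) N))
invPoch-pred (+ zero)  N = sym (cong (λ x → I N ℤ.- x) (qPow-⊛-in 0 I N z≤n) ⟨ trans ⟩ ℤP.+-inverseʳ (I N))
  where I = invPoch (+ 0)
invPoch-pred (+ suc b) = begin
  I′                                     ≈⟨ ⊛-identityʳ I′ ⟨
  I′ ⊛ oneS                              ≈⟨ ⊛-congˡ I′ (⊛-inverseʳ (qpoch (suc b)) (qpoch-0 (suc b))) ⟨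
  I′ ⊛ ((P ⊛ (oneS ⊖ x)) ⊛ I)            ≈⟨ rearrange I′ P (oneS ⊖ x) I ⟩
  (P ⊛ I′) ⊛ ((oneS ⊖ x) ⊛ I)            ≈⟨ ⊛-cong (⊛-inverseʳ P (qpoch-0 b)) (oneMinus-⊛ x I) ⟩
  oneS ⊛ (I ⊖ x ⊛ I)                     ≈⟨ ⊛-identityˡ _ ⟩
  I ⊖ x ⊛ I                              ∎
  where
  open ≋-Reasoning
  P = qpoch b
  x = qPow (suc b)
  I = invPoch (+ suc b)
  I′ = invPoch (+ b)
  rearrange : ∀ I′ P y I → I′ ⊛ ((P ⊛ y) ⊛ I) ≋ (P ⊛ I′) ⊛ (y ⊛ I)
  rearrange = solve 4 (λ I′ P y I → I′ :* ((P :* y) :* I) := (P :* I′) :* (y :* I)) (λ _ → refl)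

-- Either a, b ≥ 0, so that ∣a∣ + ∣b∣ = e, or one of the factors 1/(q;q) vanishes.
qPow-⊛-invPoch² : ∀ a b e → a ℤ.+ b ≡ + e →
  qPow e ⊛ (invPoch a ⊛ invPoch b) ≋ (qPow ∣ a ∣ ⊛ qPow ∣ b ∣) ⊛ (invPoch a ⊛ invPoch b)
qPow-⊛-invPoch² (+ a)    (+ b)    e a+b≡e = ⊛-congʳ (invPoch (+ a) ⊛ invPoch (+ b)) (≋-sym (≋-trans (qPow-+ a b) λ N →
  cong (λ k → qPow k N) (ℤP.+-injective (sym (ℤP.pos-+ a b) ⟨ trans ⟩ a+b≡e))))
qPow-⊛-invPoch² -[1+ a ] b        e _ =
  ≋-trans (vanish (qPow e)) (≋-sym (vanish (qPow (suc a) ⊛ qPow ∣ b ∣)))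
  where
  vanish : ∀ f → f ⊛ (zeroS ⊛ invPoch b) ≋ zeroS
  vanish f = ≋-trans (⊛-congˡ f (⊛-zeroˡ (invPoch b))) (⊛-zeroʳ f)
qPow-⊛-invPoch² (+ a)    -[1+ b ] e _ =
  ≋-trans (vanish (qPow e)) (≋-sym (vanish (qPow a ⊛ qPow (suc b))))
  where
  vanish : ∀ f → f ⊛ (invPoch (+ a) ⊛ zeroS) ≋ zeroS
  vanish f = ≋-trans (⊛-congˡ f (⊛-zeroʳ (invPoch (+ a)))) (⊛-zeroʳ f)

invPoch²-rec : ∀ a b e → a ℤ.+ b ≡ + e →
  (oneS ⊖ qPow e) ⊛ (invPoch a ⊛ invPoch b) ≋
  invPoch (a ℤ.- + 1) ⊛ invPoch b ⊕ invPoch a ⊛ invPoch (b ℤ.- + 1) ⊖ invPoch (a ℤ.- + 1) ⊛ invPoch (b ℤ.- + 1)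
invPoch²-rec a b e a+b≡e = begin
  (oneS ⊖ qPow e) ⊛ (A ⊛ B)
    ≈⟨ oneMinus-⊛ (qPow e) (A ⊛ B) ⟩
  A ⊛ B ⊖ qPow e ⊛ (A ⊛ B)
    ≈⟨ ⊕-congˡ (A ⊛ B) (⊝-cong (qPow-⊛-invPoch² a b e a+b≡e)) ⟩
  A ⊛ B ⊖ (x ⊛ y) ⊛ (A ⊛ B)
    ≈⟨ expand A B x y ⟩
  (A ⊖ x ⊛ A) ⊛ B ⊕ A ⊛ (B ⊖ y ⊛ B) ⊖ (A ⊖ x ⊛ A) ⊛ (B ⊖ y ⊛ B)
    ≈⟨ ⊕-cong (⊕-cong (⊛-congʳ B A′) (⊛-congˡ A B′)) (⊝-cong (⊛-cong A′ B′)) ⟨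
  invPoch (a ℤ.- + 1) ⊛ B ⊕ A ⊛ invPoch (b ℤ.- + 1) ⊖ invPoch (a ℤ.- + 1) ⊛ invPoch (b ℤ.- + 1)
    ∎
  where
  open ≋-Reasoning
  A = invPoch a
  B = invPoch b
  x = qPow ∣ a ∣
  y = qPow ∣ b ∣
  A′ = invPoch-pred a
  B′ = invPoch-pred b
  expand : ∀ A B x y →
    A ⊛ B ⊖ (x ⊛ y) ⊛ (A ⊛ B) ≋ (A ⊖ x ⊛ A) ⊛ B ⊕ A ⊛ (B ⊖ y ⊛ B) ⊖ (A ⊖ x ⊛ A) ⊛ (B ⊖ y ⊛ B)
  expand = solve 4 (λ A B x y → A :* B :- (x :* y) :* (A :* B) :=
                                (A :- x :* A) :* B :+ A :* (B :- y :* B) :- (A :- x :* A) :* (B :- y :* B))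
                   (λ _ → refl)

private
  pred-sub-3r : ∀ p r → p ℤ.- + 1 ℤ.- + 3 ℤ.* r ≡ p ℤ.- + 3 ℤ.* r ℤ.- + 1
  pred-sub-3r = solve-∀
  pred-add-3r : ∀ m r → m ℤ.- + 1 ℤ.+ + 3 ℤ.* r ≡ m ℤ.+ + 3 ℤ.* r ℤ.- + 1
  pred-add-3r = solve-∀

thetaTerm-rec : ∀ p m r e → p ℤ.+ m ≡ + e →
  (oneS ⊖ qPow e) ⊛ thetaTerm p m r ≋
  thetaTerm (p ℤ.- + 1) m r ⊕ thetaTerm p (m ℤ.- + 1) r ⊖ thetaTerm (p ℤ.- + 1) (m ℤ.- + 1) r
thetaTerm-rec p m r e p+m≡e rewrite pred-sub-3r p r | pred-add-3r m r = begin
  (oneS ⊖ qPow e) ⊛ (w ⊛ (A ⊛ B))                   ≈⟨ swap (oneS ⊖ qPow e) w (A ⊛ B) ⟩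
  w ⊛ ((oneS ⊖ qPow e) ⊛ (A ⊛ B))                   ≈⟨ ⊛-congˡ w (invPoch²-rec a b e (split p m r ⟨ trans ⟩ p+m≡e)) ⟩
  w ⊛ (A′ ⊛ B ⊕ A ⊛ B′ ⊖ A′ ⊛ B′)                  ≈⟨ distribute w (A′ ⊛ B) (A ⊛ B′) (A′ ⊛ B′) ⟩
  w ⊛ (A′ ⊛ B) ⊕ w ⊛ (A ⊛ B′) ⊖ w ⊛ (A′ ⊛ B′)      ∎
  where
  open ≋-Reasoning
  a = p ℤ.- + 3 ℤ.* r
  b = m ℤ.+ + 3 ℤ.* r
  w = weight r
  A = invPoch a
  B = invPoch b
  A′ = invPoch (a ℤ.- + 1)
  B′ = invPoch (b ℤ.- + 1)
  split : ∀ p m r → p ℤ.- + 3 ℤ.* r ℤ.+ (m ℤ.+ + 3 ℤ.* r) ≡ p ℤ.+ m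
  split = solve-∀
  swap : ∀ x y z → x ⊛ (y ⊛ z) ≋ y ⊛ (x ⊛ z)
  swap = solve 3 (λ x y z → x :* (y :* z) := y :* (x :* z)) (λ _ → refl)
  distribute : ∀ w u v t → w ⊛ (u ⊕ v ⊖ t) ≋ w ⊛ u ⊕ w ⊛ v ⊖ w ⊛ t
  distribute = solve 4 (λ w u v t → w :* (u :+ v :- t) := w :* u :+ w :* v :- w :* t) (λ _ → refl)

invPoch-vanishes : ∀ {z} → z ℤ.< + 0 → invPoch z ≋ zeroS
invPoch-vanishes { -[1+ _ ]} _         = ≋-refl
invPoch-vanishes {+ _}      (ℤ.+<+ ())

thetaTerm-vanishes : ∀ p m k → p ℤ.< + (3 ℕ.* k) → thetaTerm p m (+ k) ≋ zeroS
thetaTerm-vanishes p m k p<3k = ≋-trans (⊛-congˡ w (⊛-congʳ B (invPoch-vanishes (i<j⇒i-j<0 p<3k′))))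
  (≋-trans (⊛-congˡ w (⊛-zeroˡ B)) (⊛-zeroʳ w))
  where
  w = weight (+ k)
  B = invPoch (m ℤ.+ + 3 ℤ.* + k)
  i<j⇒i-j<0 : ∀ {i j} → i ℤ.< j → i ℤ.- j ℤ.< + 0
  i<j⇒i-j<0 {i} {j} i<j = subst (i ℤ.- j ℤ.<_) (ℤP.+-inverseʳ j) (ℤP.+-monoˡ-< (ℤ.- j) i<j)
  p<3k′ : p ℤ.< + 3 ℤ.* + k
  p<3k′ = subst (p ℤ.<_) (ℤP.pos-* 3 k) p<3k

thetaTerm-neg : ∀ p m r → thetaTerm p m (ℤ.- r) ≋ thetaTerm m p r
thetaTerm-neg p m r = ≋-trans (≋-reflexive
  (cong (λ w → w ⊛ (invPoch (p ℤ.- + 3 ℤ.* (ℤ.- r)) ⊛ invPoch (m ℤ.+ + 3 ℤ.* (ℤ.- r)))) weight-neg ⟨ trans ⟩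
   cong₂ (λ a b → weight r ⊛ (invPoch a ⊛ invPoch b)) (flipˡ p r) (flipʳ m r)))
  (⊛-congˡ (weight r) (⊛-comm (invPoch (p ℤ.+ + 3 ℤ.* r)) (invPoch (m ℤ.- + 3 ℤ.* r))))
  where
  weight-neg : weight (ℤ.- r) ≡ weight r
  weight-neg = cong (λ k → scalar (negOnePow k) ⊛ qPow (3 ℕ.* (k ℕ.* k))) (ℤP.∣-i∣≡∣i∣ r)
  flipˡ : ∀ p r → p ℤ.- + 3 ℤ.* (ℤ.- r) ≡ p ℤ.+ + 3 ℤ.* r
  flipˡ = solve-∀
  flipʳ : ∀ m r → m ℤ.+ + 3 ℤ.* (ℤ.- r) ≡ m ℤ.- + 3 ℤ.* r
  flipʳ = solve-∀

Z-as-sumRange : ∀ p m {K L} → ∣ m ∣ ≤ K → ∣ p ∣ ≤ L → Z p m ≋ sumRangeS K L (thetaTerm p m)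
Z-as-sumRange p m ∣m∣≤K ∣p∣≤L N = sym (sumRange-shrink (λ r → thetaTerm p m r N) ∣m∣≤K ∣p∣≤L
  (λ k ∣m∣≤k → ≋-trans (thetaTerm-neg p m (+ suc k)) (thetaTerm-vanishes m p (suc k) (below m (s≤s ∣m∣≤k))) N)
  (λ l ∣p∣<l → thetaTerm-vanishes p m l (below p ∣p∣<l) N))
  where
  i≤∣i∣ : ∀ i → i ℤ.≤ + ∣ i ∣
  i≤∣i∣ (+ _)    = ℤP.≤-refl
  i≤∣i∣ -[1+ _ ] = ℤ.-≤+
  below : ∀ i {k} → ∣ i ∣ < k → i ℤ.< + (3 ℕ.* k)
  below i {k} ∣i∣<k = ℤP.≤-<-trans (i≤∣i∣ i) (ℤ.+<+ (ℕP.<-≤-trans ∣i∣<k (ℕP.m≤n*m k 3)))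

Z-rec : ∀ p m → (oneS ⊖ qPow (p ℕ.+ m)) ⊛ Z (+ p) (+ m) ≋
  Z (+ p ℤ.- + 1) (+ m) ⊕ Z (+ p) (+ m ℤ.- + 1) ⊖ Z (+ p ℤ.- + 1) (+ m ℤ.- + 1)
Z-rec p m = begin
  X ⊛ Z (+ p) (+ m)
    ≈⟨ ⊛-congˡ X (Z-as-sumRange (+ p) (+ m) (ℕP.n≤1+n m) (ℕP.n≤1+n p)) ⟩
  X ⊛ sumRangeS K L (thetaTerm (+ p) (+ m))
    ≈⟨ ⊛-sumRangeS K L X (thetaTerm (+ p) (+ m)) ⟩
  sumRangeS K L (λ r → X ⊛ thetaTerm (+ p) (+ m) r)
    ≈⟨ sumRangeS-cong K L (λ r → thetaTerm-rec (+ p) (+ m) r (p ℕ.+ m) (sym (ℤP.pos-+ p m))) ⟩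
  sumRangeS K L (λ r → F₁ r ⊕ F₂ r ⊖ F₃ r)
    ≈⟨ ≋-trans (sumRangeS-⊕ K L (λ r → F₁ r ⊕ F₂ r) (λ r → ⊝ F₃ r))
               (⊕-cong (sumRangeS-⊕ K L F₁ F₂) (sumRangeS-⊝ K L F₃)) ⟩
  sumRangeS K L F₁ ⊕ sumRangeS K L F₂ ⊖ sumRangeS K L F₃
    ≈⟨ ⊕-cong (⊕-cong (Z-as-sumRange (+ p ℤ.- + 1) (+ m) (ℕP.n≤1+n m) (∣pred∣≤ p))
                      (Z-as-sumRange (+ p) (+ m ℤ.- + 1) (∣pred∣≤ m) (ℕP.n≤1+n p)))
              (⊝-cong (Z-as-sumRange (+ p ℤ.- + 1) (+ m ℤ.- + 1) (∣pred∣≤ m) (∣pred∣≤ p))) ⟨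
  Z (+ p ℤ.- + 1) (+ m) ⊕ Z (+ p) (+ m ℤ.- + 1) ⊖ Z (+ p ℤ.- + 1) (+ m ℤ.- + 1) ∎
  where
  open ≋-Reasoning
  X = oneS ⊖ qPow (p ℕ.+ m)
  K = suc m
  L = suc p
  F₁ = thetaTerm (+ p ℤ.- + 1) (+ m)
  F₂ = thetaTerm (+ p) (+ m ℤ.- + 1)
  F₃ = thetaTerm (+ p ℤ.- + 1) (+ m ℤ.- + 1)
  ∣pred∣≤ : ∀ k → ∣ + k ℤ.- + 1 ∣ ≤ suc k
  ∣pred∣≤ zero    = s≤s z≤n
  ∣pred∣≤ (suc k) = ℕP.m≤n⇒m≤1+n (ℕP.n≤1+n k)

Z-sym : ∀ p m → Z p m ≋ Z m p
Z-sym p m = begin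
  Z p m                                        ≈⟨ Z-as-sumRange p m (ℕP.m≤n+m ∣ m ∣ ∣ p ∣) (ℕP.m≤m+n ∣ p ∣ ∣ m ∣) ⟩
  sumRangeS K K (thetaTerm p m)                ≈⟨ (λ N → sumRange-symmetric K (λ r → thetaTerm p m r N)) ⟩
  sumRangeS K K (λ r → thetaTerm p m (ℤ.- r))  ≈⟨ sumRangeS-cong K K (thetaTerm-neg p m) ⟩
  sumRangeS K K (thetaTerm m p)                ≈⟨ Z-as-sumRange m p (ℕP.m≤m+n ∣ p ∣ ∣ m ∣) (ℕP.m≤n+m ∣ m ∣ ∣ p ∣) ⟨
  Z m p                                        ∎
  where
  open ≋-Reasoning
  K = ∣ p ∣ ℕ.+ ∣ m ∣

Z-zero-zero : Z (+ 0) (+ 0) ≋ oneS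
Z-zero-zero = begin
  (scalar (+ 1) ⊛ qPow 0) ⊛ (inv oneS ⊛ inv oneS)
    ≈⟨ ⊛-cong (⊛-cong scalar-one (≋-sym oneS≋qPow0)) (⊛-cong inv-one inv-one) ⟩
  (oneS ⊛ oneS) ⊛ (oneS ⊛ oneS)                       ≈⟨ ⊛-cong (⊛-identityˡ oneS) (⊛-identityˡ oneS) ⟩
  oneS ⊛ oneS                                         ≈⟨ ⊛-identityˡ oneS ⟩
  oneS                                                ∎
  where
  open ≋-Reasoning
  scalar-one : scalar (+ 1) ≋ oneS
  scalar-one N = ℤP.*-identityˡ (oneS N)
  inv-one : inv oneS ≋ oneS
  inv-one = ≋-trans (≋-sym (⊛-identityˡ (inv oneS))) (⊛-inverseʳ oneS refl)

Z-minusOne : ∀ p → p ≤ 2 → Z (+ p) (ℤ.- + 1) ≋ zeroS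
Z-minusOne p p≤2 N = sumUpTo-zero (1 ℕ.+ p) λ i _ → vanishes (+ i ℤ.- + 1) N
  where
  vanishes : ∀ r → thetaTerm (+ p) (ℤ.- + 1) r ≋ zeroS
  vanishes (+ suc k)  =
    thetaTerm-vanishes (+ p) (ℤ.- + 1) (suc k) (ℤ.+<+ (ℕP.<-≤-trans (s≤s p≤2) (ℕP.*-monoʳ-≤ 3 (s≤s z≤n))))
  vanishes (+ zero)   = ≋-trans (thetaTerm-neg (+ p) (ℤ.- + 1) (+ 0)) (thetaTerm-vanishes (ℤ.- + 1) (+ p) 0 ℤ.-<+)
  vanishes -[1+ k ]   = ≋-trans (thetaTerm-neg (+ p) (ℤ.- + 1) (+ suc k)) (thetaTerm-vanishes (ℤ.- + 1) (+ p) (suc k) ℤ.-<+)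

weight-⊛-qPow : ∀ r u X → weight r ⊛ (qPow u ⊛ X) ≋ scalar (sign r) ⊛ (qPow (exponent r ℕ.+ u) ⊛ X)
weight-⊛-qPow r u X = ≋-trans (reassociate (scalar (sign r)) (qPow (exponent r)) (qPow u) X)
  (⊛-congˡ (scalar (sign r)) (⊛-congʳ X (qPow-+ (exponent r) u)))
  where
  reassociate : ∀ s Q U X → (s ⊛ Q) ⊛ (U ⊛ X) ≋ s ⊛ ((Q ⊛ U) ⊛ X)
  reassociate = solve 4 (λ s Q U X → (s :* Q) :* (U :* X) := s :* ((Q :* U) :* X)) (λ _ → refl)

-- Z(a+3, a) - Z(a+2, a) = Σ_r H r with H (1 - r) = - H r, summed over a range symmetric under r ↦ 1 - r.
module _ (a : ℕ) where
  private
    c d : ℤ → ℤ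
    c r = + a ℤ.+ + 3 ℤ.- + 3 ℤ.* r
    d r = + a ℤ.+ + 3 ℤ.* r

    H : ℤ → PS
    H r = weight r ⊛ (qPow ∣ c r ∣ ⊛ (invPoch (c r) ⊛ invPoch (d r)))

    c-shift : ∀ k r → + (k ℕ.+ a) ℤ.- + 3 ℤ.* r ≡ c r ℤ.+ (+ k ℤ.- + 3)
    c-shift k r = cong (ℤ._- + 3 ℤ.* r) (ℤP.pos-+ k a) ⟨ trans ⟩ rearrange (+ a) (+ k) r
      where
      rearrange : ∀ a k r → k ℤ.+ a ℤ.- + 3 ℤ.* r ≡ a ℤ.+ + 3 ℤ.- + 3 ℤ.* r ℤ.+ (k ℤ.- + 3)
      rearrange = solve-∀

    thetaTerm-difference : ∀ r → thetaTerm (+ (3 ℕ.+ a)) (+ a) r ⊖ thetaTerm (+ (2 ℕ.+ a)) (+ a) r ≋ H r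
    thetaTerm-difference r = begin
      thetaTerm (+ (3 ℕ.+ a)) (+ a) r ⊖ thetaTerm (+ (2 ℕ.+ a)) (+ a) r
        ≈⟨ ≋-reflexive (cong₂ (λ u v → w ⊛ (invPoch u ⊛ B) ⊖ w ⊛ (invPoch v ⊛ B))
                              (c-shift 3 r ⟨ trans ⟩ ℤP.+-identityʳ (c r)) (c-shift 2 r)) ⟩
      w ⊛ (A ⊛ B) ⊖ w ⊛ (invPoch (c r ℤ.- + 1) ⊛ B)
        ≈⟨ ⊕-congˡ (w ⊛ (A ⊛ B)) (⊝-cong (⊛-congˡ w (⊛-congʳ B (invPoch-pred (c r))))) ⟩
      w ⊛ (A ⊛ B) ⊖ w ⊛ ((A ⊖ x ⊛ A) ⊛ B)
        ≈⟨ cancel w x A B ⟩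
      H r
        ∎
      where
      open ≋-Reasoning
      w = weight r
      x = qPow ∣ c r ∣
      A = invPoch (c r)
      B = invPoch (d r)
      cancel : ∀ w x A B → w ⊛ (A ⊛ B) ⊖ w ⊛ ((A ⊖ x ⊛ A) ⊛ B) ≋ w ⊛ (x ⊛ (A ⊛ B))
      cancel = solve 4 (λ w x A B → w :* (A :* B) :- w :* ((A :- x :* A) :* B) := w :* (x :* (A :* B))) (λ _ → refl)

    sign-reflect : ∀ r → sign (+ 1 ℤ.- r) ≡ ℤ.- sign r
    sign-reflect (+ zero)          = refl
    sign-reflect (+ suc zero)      = refl
    sign-reflect (+ suc (suc n))   = sym (ℤP.neg-involutive (negOnePow (suc n)))
    sign-reflect -[1+ n ]          = refl

    exponent-reflect : ∀ r {u v} → c r ≡ + u → d r ≡ + v →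
      exponent (+ 1 ℤ.- r) ℕ.+ v ≡ exponent r ℕ.+ u
    exponent-reflect r {u} {v} c≡u d≡v = ℤP.+-injective (begin
      + (exponent (+ 1 ℤ.- r) ℕ.+ v)                  ≡⟨ cong₂ ℤ._+_ (exponent-ℤ (+ 1 ℤ.- r)) (sym d≡v) ⟩
      + 3 ℤ.* ((+ 1 ℤ.- r) ℤ.* (+ 1 ℤ.- r)) ℤ.+ d r   ≡⟨ complete-square (+ a) r ⟩
      + 3 ℤ.* (r ℤ.* r) ℤ.+ c r                       ≡⟨ cong₂ ℤ._+_ (exponent-ℤ r) (sym c≡u) ⟨
      + (exponent r ℕ.+ u)                            ∎)
      where
      open ≡-Reasoning
      exponent-ℤ : ∀ s → + exponent s ≡ + 3 ℤ.* (s ℤ.* s)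
      exponent-ℤ s = ℤP.pos-* 3 (∣ s ∣ ℕ.* ∣ s ∣) ⟨ trans ⟩ cong (+ 3 ℤ.*_) (square s)
        where
        square : ∀ s → + (∣ s ∣ ℕ.* ∣ s ∣) ≡ s ℤ.* s
        square (+ n)    = ℤP.pos-* n n
        square -[1+ n ] = refl
      complete-square : ∀ a r → + 3 ℤ.* ((+ 1 ℤ.- r) ℤ.* (+ 1 ℤ.- r)) ℤ.+ (a ℤ.+ + 3 ℤ.* r) ≡
                                + 3 ℤ.* (r ℤ.* r) ℤ.+ (a ℤ.+ + 3 ℤ.- + 3 ℤ.* r)
      complete-square = solve-∀

    H-reflect-body : ∀ r u v → c r ≡ u → d r ≡ v →
      weight (+ 1 ℤ.- r) ⊛ (qPow ∣ v ∣ ⊛ (invPoch v ⊛ invPoch u)) ≋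
      ⊝ (weight r ⊛ (qPow ∣ u ∣ ⊛ (invPoch u ⊛ invPoch v)))
    H-reflect-body r -[1+ k ] v _ _ =
      ≋-trans (⊛-zero-inner (weight (+ 1 ℤ.- r)) (qPow ∣ v ∣) (⊛-zeroʳ (invPoch v)))
              (≋-sym (⊝-cong (⊛-zero-inner (weight r) (qPow (suc k)) (⊛-zeroˡ (invPoch v)))))
    H-reflect-body r (+ u) -[1+ k ] _ _ =
      ≋-trans (⊛-zero-inner (weight (+ 1 ℤ.- r)) (qPow (suc k)) (⊛-zeroˡ (invPoch (+ u))))
              (≋-sym (⊝-cong (⊛-zero-inner (weight r) (qPow u) (⊛-zeroʳ (invPoch (+ u))))))
    H-reflect-body r (+ u) (+ v) c≡u d≡v = begin
      weight (+ 1 ℤ.- r) ⊛ (qPow v ⊛ (V ⊛ U))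
        ≈⟨ weight-⊛-qPow (+ 1 ℤ.- r) v (V ⊛ U) ⟩
      scalar (sign (+ 1 ℤ.- r)) ⊛ (qPow (exponent (+ 1 ℤ.- r) ℕ.+ v) ⊛ (V ⊛ U))
        ≈⟨ ≋-reflexive (cong₂ (λ s e → scalar s ⊛ (qPow e ⊛ (V ⊛ U))) (sign-reflect r) (exponent-reflect r c≡u d≡v)) ⟩
      scalar (ℤ.- sign r) ⊛ (qPow e ⊛ (V ⊛ U))
        ≈⟨ scalar-neg-⊛ (sign r) (qPow e ⊛ (V ⊛ U)) ⟩
      ⊝ (scalar (sign r) ⊛ (qPow e ⊛ (V ⊛ U)))
        ≈⟨ ⊝-cong (⊛-congˡ (scalar (sign r)) (⊛-congˡ (qPow e) (⊛-comm V U))) ⟩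
      ⊝ (scalar (sign r) ⊛ (qPow e ⊛ (U ⊛ V)))
        ≈⟨ ⊝-cong (weight-⊛-qPow r u (U ⊛ V)) ⟨
      ⊝ (weight r ⊛ (qPow u ⊛ (U ⊛ V)))
        ∎
      where
      open ≋-Reasoning
      U = invPoch (+ u)
      V = invPoch (+ v)
      e = exponent r ℕ.+ u

    H-antisymmetric : ∀ r → H (+ 1 ℤ.- r) ≋ ⊝ H r
    H-antisymmetric r = ≋-trans
      (≋-reflexive (cong₂ (λ u v → weight (+ 1 ℤ.- r) ⊛ (qPow ∣ u ∣ ⊛ (invPoch u ⊛ invPoch v)))
                          (c-reflect (+ a) r) (d-reflect (+ a) r)))
      (H-reflect-body r (c r) (d r) refl refl)
      where
      c-reflect : ∀ a r → a ℤ.+ + 3 ℤ.- + 3 ℤ.* (+ 1 ℤ.- r) ≡ a ℤ.+ + 3 ℤ.* r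
      c-reflect = solve-∀
      d-reflect : ∀ a r → a ℤ.+ + 3 ℤ.* (+ 1 ℤ.- r) ≡ a ℤ.+ + 3 ℤ.- + 3 ℤ.* r
      d-reflect = solve-∀

  Z-neumann : Z (+ (3 ℕ.+ a)) (+ a) ≋ Z (+ (2 ℕ.+ a)) (+ a)
  Z-neumann N = ℤP.i-j≡0⇒i≡j _ _ (begin
    Z (+ (3 ℕ.+ a)) (+ a) N ℤ.- Z (+ (2 ℕ.+ a)) (+ a) N
      ≡⟨ cong₂ ℤ._-_ (Z-as-sumRange (+ (3 ℕ.+ a)) (+ a) a≤K (ℕP.n≤1+n K) N)
                     (Z-as-sumRange (+ (2 ℕ.+ a)) (+ a) a≤K (ℕP.m≤n⇒m≤1+n (ℕP.n≤1+n (2 ℕ.+ a))) N) ⟩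
    (sumRangeS K (suc K) T₃ ⊖ sumRangeS K (suc K) T₂) N
      ≡⟨ ⊕-congˡ (sumRangeS K (suc K) T₃) (sumRangeS-⊝ K (suc K) T₂) N ⟨
    (sumRangeS K (suc K) T₃ ⊕ sumRangeS K (suc K) (λ r → ⊝ T₂ r)) N
      ≡⟨ sumRangeS-⊕ K (suc K) T₃ (λ r → ⊝ T₂ r) N ⟨
    sumRangeS K (suc K) (λ r → T₃ r ⊖ T₂ r) N
      ≡⟨ sumRangeS-cong K (suc K) thetaTerm-difference N ⟩
    sumRange K (suc K) (λ r → H r N)
      ≡⟨ sumRange-antisymmetric K (λ r → H r N) (λ r → H-antisymmetric r N) ⟩
    + 0 ∎)
    where
    open ≡-Reasoning
    K = 3 ℕ.+ a
    a≤K = ℕP.m≤n+m a 3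
    T₃ = thetaTerm (+ (3 ℕ.+ a)) (+ a)
    T₂ = thetaTerm (+ (2 ℕ.+ a)) (+ a)

-- The right-hand side is Z(n, n)

qbin-invPoch : ∀ a z → qbin a z ≋ qpoch a ⊛ (invPoch z ⊛ invPoch (+ a ℤ.- z))
qbin-invPoch a -[1+ k ] = ≋-sym (⊛-zero-inner (qpoch a) zeroS ≋-refl)
qbin-invPoch a (+ b) N with b ℕ.≤? a
... | yes b≤a = cong (λ z → (qpoch a ⊛ (inv (qpoch b) ⊛ invPoch z)) N) (sym (ℤP.m-n≡m⊖n a b ⟨ trans ⟩ ℤP.⊖-≥ b≤a))
... | no b≰a  = sym (⊛-zero-inner (qpoch a) (invPoch (+ b)) (invPoch-vanishes a-b<0) N)
  where
  a<b = ℕP.≰⇒> b≰a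
  a-b<0 : + a ℤ.- + b ℤ.< + 0
  a-b<0 = subst (ℤ._< + 0) (sym (ℤP.m-n≡m⊖n a b ⟨ trans ⟩ ℤP.⊖-< a<b)) (ℤP.neg-mono-< (ℤ.+<+ (ℕP.m<n⇒0<n∸m a<b)))

summand-thetaTerm : ∀ n r → summand n r ≋ qpoch (2 ℕ.* n) ⊛ thetaTerm (+ n) (+ n) r
summand-thetaTerm n r = begin
  summand n r                                              ≈⟨ (λ N → sym (scalar-⊛ s (Q ⊛ qbin (2 ℕ.* n) z) N)) ⟩
  scalar s ⊛ (Q ⊛ qbin (2 ℕ.* n) z)                        ≈⟨ ⊛-congˡ (scalar s) (⊛-congˡ Q (qbin-invPoch (2 ℕ.* n) z)) ⟩
  scalar s ⊛ (Q ⊛ (P ⊛ (invPoch z ⊛ invPoch (+ (2 ℕ.* n) ℤ.- z))))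
    ≈⟨ ≋-reflexive (cong (λ y → scalar s ⊛ (Q ⊛ (P ⊛ (invPoch z ⊛ invPoch y)))) complement) ⟩
  scalar s ⊛ (Q ⊛ (P ⊛ X))                                 ≈⟨ rearrange (scalar s) Q P X ⟩
  P ⊛ thetaTerm (+ n) (+ n) r                              ∎
  where
  open ≋-Reasoning
  s = sign r
  Q = qPow (exponent r)
  P = qpoch (2 ℕ.* n)
  z = + n ℤ.- + 3 ℤ.* r
  X = invPoch z ⊛ invPoch (+ n ℤ.+ + 3 ℤ.* r)
  twice : ∀ m r → + 2 ℤ.* m ℤ.- (m ℤ.- + 3 ℤ.* r) ≡ m ℤ.+ + 3 ℤ.* r
  twice = solve-∀
  complement : + (2 ℕ.* n) ℤ.- z ≡ + n ℤ.+ + 3 ℤ.* r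
  complement = cong (ℤ._- z) (ℤP.pos-* 2 n) ⟨ trans ⟩ twice (+ n) r
  rearrange : ∀ S Q P X → S ⊛ (Q ⊛ (P ⊛ X)) ≋ P ⊛ ((S ⊛ Q) ⊛ X)
  rearrange = solve 4 (λ S Q P X → S :* (Q :* (P :* X)) := P :* ((S :* Q) :* X)) (λ _ → refl)

weight-⊛-vanishes : ∀ r f {N} → N < exponent r → (weight r ⊛ f) N ≡ + 0
weight-⊛-vanishes r f {N} N<3r² =
  reorder (scalar (sign r)) Q f N ⟨ trans ⟩ qPow-⊛-out (exponent r) (scalar (sign r) ⊛ f) N N<3r²
  where
  Q = qPow (exponent r)
  reorder : ∀ S Q f → (S ⊛ Q) ⊛ f ≋ Q ⊛ (S ⊛ f)
  reorder = solve 3 (λ S Q f → (S :* Q) :* f := Q :* (S :* f)) (λ _ → refl)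

thetaSum-Z : ∀ n → thetaSum n ≋ qpoch (2 ℕ.* n) ⊛ Z (+ n) (+ n)
thetaSum-Z n N = begin
  sumUpTo (2 ℕ.* N) (λ i → summand n (+ i ℤ.- + N) N)
    ≡⟨ cong (λ k → sumUpTo (N ℕ.+ k) (λ i → summand n (+ i ℤ.- + N) N)) (ℕP.+-identityʳ N) ⟩
  sumRange N N (λ r → summand n r N)
    ≡⟨ sumRange-ext N N (λ r → summand-thetaTerm n r N) ⟩
  sumRange N N G
    ≡⟨ sumRange-shrink G (ℕP.m≤m+n N n) (ℕP.m≤m+n N n) vanishˡ-N vanishʳ-N ⟨
  sumRange (N ℕ.+ n) (N ℕ.+ n) G
    ≡⟨ sumRange-shrink G (ℕP.m≤n+m n N) (ℕP.m≤n+m n N) vanishˡ-n vanishʳ-n ⟩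
  sumRange n n G
    ≡⟨ ⊛-sumRangeS n n P (thetaTerm (+ n) (+ n)) N ⟨
  (P ⊛ Z (+ n) (+ n)) N ∎
  where
  open ≡-Reasoning
  P = qpoch (2 ℕ.* n)
  G : ℤ → ℤ
  G r = (P ⊛ thetaTerm (+ n) (+ n) r) N
  k≤3k² : ∀ k → k ≤ 3 ℕ.* (k ℕ.* k)
  k≤3k² zero    = z≤n
  k≤3k² (suc k) = ℕP.≤-trans (ℕP.m≤m*n (suc k) (suc k)) (ℕP.m≤n*m (suc k ℕ.* suc k) 3)
  vanish-N : ∀ r → N < ∣ r ∣ → G r ≡ + 0
  vanish-N r N<∣r∣ = swap P (weight r) X N ⟨ trans ⟩ weight-⊛-vanishes r (P ⊛ X) (ℕP.<-≤-trans N<∣r∣ (k≤3k² ∣ r ∣))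
    where
    X = invPoch (+ n ℤ.- + 3 ℤ.* r) ⊛ invPoch (+ n ℤ.+ + 3 ℤ.* r)
    swap : ∀ x y z → x ⊛ (y ⊛ z) ≋ y ⊛ (x ⊛ z)
    swap = solve 3 (λ x y z → x :* (y :* z) := y :* (x :* z)) (λ _ → refl)
  vanishˡ-N : ∀ k → N ≤ k → G -[1+ k ] ≡ + 0
  vanishˡ-N k N≤k = vanish-N -[1+ k ] (s≤s N≤k)
  vanishʳ-N : ∀ k → N < k → G (+ k) ≡ + 0
  vanishʳ-N k = vanish-N (+ k)
  vanish-n : ∀ r → thetaTerm (+ n) (+ n) r ≋ zeroS → G r ≡ + 0
  vanish-n r θ≋0 = ≋-trans (⊛-congˡ P θ≋0) (⊛-zeroʳ P) N
  vanishˡ-n : ∀ k → n ≤ k → G -[1+ k ] ≡ + 0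
  vanishˡ-n k n≤k = vanish-n -[1+ k ] (≋-trans (thetaTerm-neg (+ n) (+ n) (+ suc k))
    (thetaTerm-vanishes (+ n) (+ n) (suc k) (ℤ.+<+ (ℕP.<-≤-trans (s≤s n≤k) (ℕP.m≤n*m (suc k) 3)))))
  vanishʳ-n : ∀ k → n < k → G (+ k) ≡ + 0
  vanishʳ-n k n<k = vanish-n (+ k) (thetaTerm-vanishes (+ n) (+ n) k (ℤ.+<+ (ℕP.<-≤-trans n<k (ℕP.m≤n*m k 3))))

rhs-Z : ∀ n → rhs n ≋ Z (+ n) (+ n)
rhs-Z n = begin
  inv P ⊛ thetaSum n            ≈⟨ ⊛-congˡ (inv P) (thetaSum-Z n) ⟩
  inv P ⊛ (P ⊛ Z (+ n) (+ n))   ≈⟨ reassociate (inv P) P (Z (+ n) (+ n)) ⟩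
  (P ⊛ inv P) ⊛ Z (+ n) (+ n)   ≈⟨ ⊛-congʳ (Z (+ n) (+ n)) (⊛-inverseʳ P (qpoch-0 (2 ℕ.* n))) ⟩
  oneS ⊛ Z (+ n) (+ n)          ≈⟨ ⊛-identityˡ (Z (+ n) (+ n)) ⟩
  Z (+ n) (+ n)                 ∎
  where
  open ≋-Reasoning
  P = qpoch (2 ℕ.* n)
  reassociate : ∀ I P f → I ⊛ (P ⊛ f) ≋ (P ⊛ I) ⊛ f
  reassociate = solve 3 (λ I P f → I :* (P :* f) := (P :* I) :* f) (λ _ → refl)

-- The clamped sums W and their mixed differences

Zℕ : ℕ → ℕ → PS
Zℕ p m = Z (+ p) (+ m)

Admissible : ℕ → ℕ → Set
Admissible p m = p ≤ 2 ℕ.+ m × m ≤ 2 ℕ.+ p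

admissible? : ∀ p m → Dec (Admissible p m)
admissible? p m = p ℕ.≤? 2 ℕ.+ m ×-dec m ℕ.≤? 2 ℕ.+ p

-- The generating function of cylindric partitions of profile (2,2) whose two partitions have at most
-- p and m parts; λ⁽¹⁾ has at most two parts more than λ⁽²⁾ and vice versa, hence the clamping.
W : ℕ → ℕ → PS
W p m = Zℕ (p ⊓ (2 ℕ.+ m)) (m ⊓ (2 ℕ.+ p))

W-admissible : ∀ {p m} → Admissible p m → W p m ≋ Zℕ p m
W-admissible (p≤2+m , m≤2+p) rewrite ℕP.m≤n⇒m⊓n≡m p≤2+m | ℕP.m≤n⇒m⊓n≡m m≤2+p = ≋-refl

W-clamp : ∀ {p m} → 2 ℕ.+ m ≤ p → W p m ≋ Zℕ (2 ℕ.+ m) m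
W-clamp {p} {m} 2+m≤p
  rewrite ℕP.m≥n⇒m⊓n≡n 2+m≤p
        | ℕP.m≤n⇒m⊓n≡m (ℕP.≤-trans (ℕP.m≤n+m m 2) (ℕP.≤-trans 2+m≤p (ℕP.m≤n+m p 2))) = ≋-refl

W-sym : ∀ p m → W p m ≋ W m p
W-sym p m = Z-sym (+ (p ⊓ (2 ℕ.+ m))) (+ (m ⊓ (2 ℕ.+ p)))

-- The generating function of the pairs with exactly p and m parts (remove their first column).
exactGF : ℕ → ℕ → PS
exactGF p m with admissible? p m
... | yes _ = qPow (p ℕ.+ m) ⊛ W p m
... | no _  = zeroS

exactGF-admissible : ∀ {p m} → Admissible p m → exactGF p m ≋ qPow (p ℕ.+ m) ⊛ W p m
exactGF-admissible {p} {m} adm with admissible? p m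
... | yes _    = ≋-refl
... | no ¬adm = ⊥-elim (¬adm adm)

exactGF-inadmissible : ∀ {p m} → ¬ Admissible p m → exactGF p m ≋ zeroS
exactGF-inadmissible {p} {m} ¬adm with admissible? p m
... | yes adm = ⊥-elim (¬adm adm)
... | no _    = ≋-refl

exactGF-below : ∀ {p m N} → N < p ℕ.+ m → exactGF p m N ≡ + 0
exactGF-below {p} {m} {N} N<p+m with admissible? p m
... | yes _ = qPow-⊛-out (p ℕ.+ m) (W p m) N N<p+m
... | no _  = refl

exactGF-sym : ∀ p m → exactGF p m ≋ exactGF m p
exactGF-sym p m with admissible? p m | admissible? m p
... | yes _ | yes _ = ≋-trans (≋-reflexive (cong (λ e → qPow e ⊛ W p m) (ℕP.+-comm p m))) (⊛-congˡ (qPow (m ℕ.+ p)) (W-sym p m))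
... | yes (a , b) | no ¬adm = ⊥-elim (¬adm (b , a))
... | no ¬adm | yes (a , b) = ⊥-elim (¬adm (b , a))
... | no _ | no _ = ≋-refl

Δ : (ℕ → PS) → ℕ → PS
Δ f zero    = f zero
Δ f (suc k) = f (suc k) ⊖ f k

-- Mixed difference, with F (-1) _ = F _ (-1) = 0.
Δ₂ : (ℕ → ℕ → PS) → ℕ → ℕ → PS
Δ₂ F p m = Δ (λ a → Δ (F a) m) p

sumUpTo-Δ : ∀ f k N → sumUpTo k (λ i → Δ f i N) ≡ f k N
sumUpTo-Δ f zero    N = refl
sumUpTo-Δ f (suc k) N = cong (ℤ._+ Δ f (suc k) N) (sumUpTo-Δ f k N) ⟨ trans ⟩ telescope (f k N) (f (suc k) N)
  where
  telescope : ∀ x y → x ℤ.+ (y ℤ.- x) ≡ y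
  telescope = solve-∀

sumUpTo-Δ₂ : ∀ F p m N → sumUpTo p (λ a → sumUpTo m (λ b → Δ₂ F a b N)) ≡ F p m N
sumUpTo-Δ₂ F p m N = sumUpTo-swap p m (λ a b → Δ₂ F a b N) ⟨ trans ⟩
  sumUpTo-ext m (λ b → sumUpTo-Δ (λ a → Δ (F a) b) p N) ⟨ trans ⟩ sumUpTo-Δ (F p) m N

Δ₂-sym : ∀ F → (∀ a b → F a b ≋ F b a) → ∀ p m → Δ₂ F p m ≋ Δ₂ F m p
Δ₂-sym F F-sym zero    zero    = ≋-refl
Δ₂-sym F F-sym zero    (suc m) = ⊕-cong (F-sym 0 (suc m)) (⊝-cong (F-sym 0 m))
Δ₂-sym F F-sym (suc p) zero    = ⊕-cong (F-sym (suc p) 0) (⊝-cong (F-sym p 0))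
Δ₂-sym F F-sym (suc p) (suc m) N =
  cong₂ ℤ._-_ (cong₂ ℤ._-_ (F-sym (suc p) (suc m) N) (F-sym (suc p) m N))
              (cong₂ ℤ._-_ (F-sym p (suc m) N) (F-sym p m N)) ⟨ trans ⟩
  exchange (F (suc m) (suc p) N) (F m (suc p) N) (F (suc m) p N) (F m p N)
  where
  exchange : ∀ a b c d → a ℤ.- b ℤ.- (c ℤ.- d) ≡ a ℤ.- c ℤ.- (b ℤ.- d)
  exchange = solve-∀

Δ₂-cong : ∀ F G p m → F (suc p) (suc m) ≋ G (suc p) (suc m) → F (suc p) m ≋ G (suc p) m →
  F p (suc m) ≋ G p (suc m) → F p m ≋ G p m → Δ₂ F (suc p) (suc m) ≋ Δ₂ G (suc p) (suc m)
Δ₂-cong F G p m F≋G₁₁ F≋G₁₀ F≋G₀₁ F≋G₀₀ =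
  ⊕-cong (⊕-cong F≋G₁₁ (⊝-cong F≋G₁₀)) (⊝-cong (⊕-cong F≋G₀₁ (⊝-cong F≋G₀₀)))

mixed-difference : ∀ e X Y₀₁ Y₁₀ Y₀₀ → (oneS ⊖ qPow e) ⊛ X ≋ Y₀₁ ⊕ Y₁₀ ⊖ Y₀₀ →
  X ⊖ Y₁₀ ⊖ (Y₀₁ ⊖ Y₀₀) ≋ qPow e ⊛ X
mixed-difference e X Y₀₁ Y₁₀ Y₀₀ rec N = begin
  X N ℤ.- Y₁₀ N ℤ.- (Y₀₁ N ℤ.- Y₀₀ N)    ≡⟨ regroup (X N) (Y₁₀ N) (Y₀₁ N) (Y₀₀ N) ⟩
  X N ℤ.- (Y₀₁ N ℤ.+ Y₁₀ N ℤ.- Y₀₀ N)    ≡⟨ cong (ℤ._-_ (X N)) (≋-trans (≋-sym (oneMinus-⊛ (qPow e) X)) rec N) ⟨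
  X N ℤ.- (X N ℤ.- (qPow e ⊛ X) N)       ≡⟨ cancel (X N) ((qPow e ⊛ X) N) ⟩
  (qPow e ⊛ X) N                         ∎
  where
  open ≡-Reasoning
  regroup : ∀ x b a c → x ℤ.- b ℤ.- (a ℤ.- c) ≡ x ℤ.- (a ℤ.+ b ℤ.- c)
  regroup = solve-∀
  cancel : ∀ x y → x ℤ.- (x ℤ.- y) ≡ y
  cancel = solve-∀

Z-Δ₂ : ∀ p m → Δ₂ Zℕ (suc p) (suc m) ≋ qPow (suc p ℕ.+ suc m) ⊛ Zℕ (suc p) (suc m)
Z-Δ₂ p m = mixed-difference (suc p ℕ.+ suc m) (Zℕ (suc p) (suc m)) (Zℕ p (suc m)) (Zℕ (suc p) m) (Zℕ p m)
  (Z-rec (suc p) (suc m))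

Z-Δ₂-edge : ∀ p → p ≤ 1 → Δ₂ Zℕ (suc p) 0 ≋ qPow (suc p ℕ.+ 0) ⊛ Zℕ (suc p) 0
Z-Δ₂-edge p p≤1 = begin
  Zℕ (suc p) 0 ⊖ Zℕ p 0
    ≈⟨ drop-zeros ⟨
  Zℕ (suc p) 0 ⊖ Z (+ suc p) (ℤ.- + 1) ⊖ (Zℕ p 0 ⊖ Z (+ p) (ℤ.- + 1))
    ≈⟨ mixed-difference (suc p ℕ.+ 0) (Zℕ (suc p) 0) (Zℕ p 0) (Z (+ suc p) (ℤ.- + 1)) (Z (+ p) (ℤ.- + 1))
                        (Z-rec (suc p) 0) ⟩
  qPow (suc p ℕ.+ 0) ⊛ Zℕ (suc p) 0
    ∎
  where
  open ≋-Reasoning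
  drop-zeros : Zℕ (suc p) 0 ⊖ Z (+ suc p) (ℤ.- + 1) ⊖ (Zℕ p 0 ⊖ Z (+ p) (ℤ.- + 1)) ≋ Zℕ (suc p) 0 ⊖ Zℕ p 0
  drop-zeros = ⊕-cong (⊖-zero (Zℕ (suc p) 0) (Z-minusOne (suc p) (s≤s p≤1)))
                      (⊝-cong (⊖-zero (Zℕ p 0) (Z-minusOne p (ℕP.m≤n⇒m≤1+n p≤1))))

private
  Δ₂Z⇒exactGF : ∀ {p m} → Admissible p m → Δ₂ Zℕ p m ≋ qPow (p ℕ.+ m) ⊛ Zℕ p m → Δ₂ Zℕ p m ≋ exactGF p m
  Δ₂Z⇒exactGF {p} {m} adm Δ₂Z =
    ≋-trans Δ₂Z (≋-sym (≋-trans (exactGF-admissible adm) (⊛-congˡ (qPow (p ℕ.+ m)) (W-admissible adm))))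

  cancel-⊖ : ∀ f g → f ⊖ g ⊖ (f ⊖ g) ≋ zeroS
  cancel-⊖ f g N = ℤP.+-inverseʳ (f N ℤ.- g N)

Δ₂W-origin : Δ₂ W 0 0 ≋ exactGF 0 0
Δ₂W-origin = ≋-sym (≋-trans (exactGF-admissible (z≤n , z≤n))
  (≋-trans (⊛-congʳ (W 0 0) (≋-sym oneS≋qPow0)) (⊛-identityˡ (W 0 0))))

Δ₂W-edge : ∀ p → p ≤ 1 → Δ₂ W (suc p) 0 ≋ exactGF (suc p) 0
Δ₂W-edge p p≤1 =
  ≋-trans (⊕-cong (W-admissible adm₁) (⊝-cong (W-admissible adm₀))) (Δ₂Z⇒exactGF adm₁ (Z-Δ₂-edge p p≤1))
  where
  adm₁ : Admissible (suc p) 0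
  adm₁ = s≤s p≤1 , z≤n
  adm₀ : Admissible p 0
  adm₀ = ℕP.m≤n⇒m≤1+n p≤1 , z≤n

Δ₂W-interior : ∀ p m → p ≤ suc m → m ≤ suc p → Δ₂ W (suc p) (suc m) ≋ exactGF (suc p) (suc m)
Δ₂W-interior p m p≤1+m m≤1+p = ≋-trans
  (Δ₂-cong W Zℕ p m (W-admissible adm₁₁) (W-admissible adm₁₀) (W-admissible adm₀₁) (W-admissible adm₀₀))
  (Δ₂Z⇒exactGF adm₁₁ (Z-Δ₂ p m))
  where
  step = ℕP.m≤n⇒m≤1+n
  adm₁₁ : Admissible (suc p) (suc m)
  adm₁₁ = s≤s (step p≤1+m) , s≤s (step m≤1+p)
  adm₁₀ : Admissible (suc p) m
  adm₁₀ = s≤s p≤1+m , step (step m≤1+p)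
  adm₀₁ : Admissible p (suc m)
  adm₀₁ = step (step p≤1+m) , s≤s m≤1+p
  adm₀₀ : Admissible p m
  adm₀₀ = step p≤1+m , step m≤1+p

-- W (m+3) m is clamped to Z(m+2, m), which the Neumann relation turns back into Z(m+3, m).
Δ₂W-neumann : ∀ m → Δ₂ W (3 ℕ.+ m) (suc m) ≋ exactGF (3 ℕ.+ m) (suc m)
Δ₂W-neumann m = ≋-trans
  (Δ₂-cong W Zℕ (2 ℕ.+ m) m (W-admissible adm₁₁) (≋-trans (W-clamp (ℕP.n≤1+n (2 ℕ.+ m))) (≋-sym (Z-neumann m)))
                       (W-admissible adm₀₁) (W-admissible adm₀₀))
  (Δ₂Z⇒exactGF adm₁₁ (Z-Δ₂ (2 ℕ.+ m) m))
  where
  adm₁₁ : Admissible (3 ℕ.+ m) (suc m)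
  adm₁₁ = ℕP.≤-refl , ℕP.m≤n+m (suc m) 4
  adm₀₁ : Admissible (2 ℕ.+ m) (suc m)
  adm₀₁ = ℕP.n≤1+n (2 ℕ.+ m) , ℕP.m≤n+m (suc m) 3
  adm₀₀ : Admissible (2 ℕ.+ m) m
  adm₀₀ = ℕP.≤-refl , ℕP.m≤n+m m 4

Δ₂W-far : ∀ p m → 3 ℕ.+ m ≤ p → Δ₂ W (suc p) (suc m) ≋ exactGF (suc p) (suc m)
Δ₂W-far p m 3+m≤p = ≋-trans
  (Δ₂-cong W (λ a b → Zℕ (2 ℕ.+ b) b) p m
    (W-clamp (ℕP.m≤n⇒m≤1+n 3+m≤p)) (W-clamp (ℕP.m≤n⇒m≤1+n 2+m≤p)) (W-clamp 3+m≤p) (W-clamp 2+m≤p))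
  (≋-trans (cancel-⊖ (Zℕ (3 ℕ.+ m) (suc m)) (Zℕ (2 ℕ.+ m) m))
           (≋-sym (exactGF-inadmissible λ (1+p≤3+m , _) → ℕP.<⇒≱ (s≤s 3+m≤p) 1+p≤3+m)))
  where
  2+m≤p = ℕP.≤-trans (ℕP.n≤1+n (2 ℕ.+ m)) 3+m≤p

Δ₂W-far-edge : ∀ p → 2 ≤ p → Δ₂ W (suc p) 0 ≋ exactGF (suc p) 0
Δ₂W-far-edge p 2≤p = ≋-trans (⊕-cong (W-clamp (ℕP.m≤n⇒m≤1+n 2≤p)) (⊝-cong (W-clamp 2≤p)))
  (≋-trans (⊕-inverseʳ (Zℕ 2 0)) (≋-sym (exactGF-inadmissible λ (1+p≤2 , _) → ℕP.<⇒≱ (s≤s 2≤p) 1+p≤2)))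
  where
  ⊕-inverseʳ : ∀ f → f ⊖ f ≋ zeroS
  ⊕-inverseʳ f N = ℤP.+-inverseʳ (f N)

Δ₂W-below : ∀ d m → Δ₂ W (d ℕ.+ m) m ≋ exactGF (d ℕ.+ m) m
Δ₂W-below 0                   0       = Δ₂W-origin
Δ₂W-below 0                   (suc m) = Δ₂W-interior m m (ℕP.n≤1+n m) (ℕP.n≤1+n m)
Δ₂W-below 1                   0       = Δ₂W-edge 0 z≤n
Δ₂W-below 1                   (suc m) = Δ₂W-interior (suc m) m ℕP.≤-refl (ℕP.m≤n⇒m≤1+n (ℕP.n≤1+n m))
Δ₂W-below 2                   0       = Δ₂W-edge 1 ℕP.≤-refl
Δ₂W-below 2                   (suc m) = Δ₂W-neumann m
Δ₂W-below (suc (suc (suc k))) 0       = Δ₂W-far-edge (2 ℕ.+ k ℕ.+ 0) (s≤s (s≤s z≤n))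
Δ₂W-below (suc (suc (suc k))) (suc m) = Δ₂W-far (2 ℕ.+ k ℕ.+ suc m) m (s≤s (s≤s (ℕP.m≤n+m (suc m) k)))

W-Δ₂ : ∀ p m → Δ₂ W p m ≋ exactGF p m
W-Δ₂ p m with ℕP.≤-total m p
... | inj₁ m≤p = subst (λ p → Δ₂ W p m ≋ exactGF p m) (ℕP.m∸n+n≡m m≤p) (Δ₂W-below (p ∸ m) m)
... | inj₂ p≤m = ≋-trans (Δ₂-sym W W-sym p m)
  (≋-trans (subst (λ m → Δ₂ W m p ≋ exactGF m p) (ℕP.m∸n+n≡m p≤m) (Δ₂W-below (m ∸ p) p)) (exactGF-sym m p))

-- Enumerating cylindric partitions

concatUpTo : ∀ {A : Set} → ℕ → (ℕ → List A) → List A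
concatUpTo zero    E = E zero
concatUpTo (suc k) E = concatUpTo k E ++ E (suc k)

module _ {A : Set} where

  length-concatUpTo : ∀ k (E : ℕ → List A) → + length (concatUpTo k E) ≡ sumUpTo k (λ i → + length (E i))
  length-concatUpTo zero    E = refl
  length-concatUpTo (suc k) E = cong +_ (ListP.length-++ (concatUpTo k E)) ⟨ trans ⟩
    ℤP.pos-+ (length (concatUpTo k E)) (length (E (suc k))) ⟨ trans ⟩
    cong (ℤ._+ + length (E (suc k))) (length-concatUpTo k E)

  ∈-concatUpTo⁺ : ∀ {k i x} (E : ℕ → List A) → i ≤ k → x ∈ E i → x ∈ concatUpTo k E
  ∈-concatUpTo⁺ {zero}  E z≤n x∈Ei = x∈Ei
  ∈-concatUpTo⁺ {suc k} {i} E i≤1+k x∈Ei with ℕP.m≤n⇒m<n∨m≡n i≤1+k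
  ... | inj₁ i<1+k = ∈-++⁺ˡ (∈-concatUpTo⁺ E (ℕP.≤-pred i<1+k) x∈Ei)
  ... | inj₂ refl  = ∈-++⁺ʳ (concatUpTo k E) x∈Ei

  ∈-concatUpTo⁻ : ∀ {k x} (E : ℕ → List A) → x ∈ concatUpTo k E → ∃ λ i → i ≤ k × x ∈ E i
  ∈-concatUpTo⁻ {zero}  E x∈E₀ = 0 , z≤n , x∈E₀
  ∈-concatUpTo⁻ {suc k} E x∈ with ∈-++⁻ (concatUpTo k E) x∈
  ... | inj₁ x∈E≤k with ∈-concatUpTo⁻ E x∈E≤k
  ...   | i , i≤k , x∈Ei = i , ℕP.m≤n⇒m≤1+n i≤k , x∈Ei
  ∈-concatUpTo⁻ {suc k} E x∈ | inj₂ x∈Ek = suc k , ℕP.≤-refl , x∈Ek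

  concatUpTo-unique : ∀ k (E : ℕ → List A) → (∀ {i} → i ≤ k → Unique (E i)) →
    (∀ {i j x} → i ≤ k → j ≤ k → x ∈ E i → x ∈ E j → i ≡ j) → Unique (concatUpTo k E)
  concatUpTo-unique zero    E unique disjoint = unique z≤n
  concatUpTo-unique (suc k) E unique disjoint =
    Unique.++⁺ (concatUpTo-unique k E (unique ∘ ℕP.m≤n⇒m≤1+n)
                                  (λ i≤k j≤k → disjoint (ℕP.m≤n⇒m≤1+n i≤k) (ℕP.m≤n⇒m≤1+n j≤k)))
               (unique ℕP.≤-refl)
               λ (x∈E≤k , x∈Ek) → let i , i≤k , x∈Ei = ∈-concatUpTo⁻ E x∈E≤k in
                 ℕP.<⇒≢ (s≤s i≤k) (disjoint (ℕP.m≤n⇒m≤1+n i≤k) ℕP.≤-refl x∈Ei x∈Ek)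

addColumn : ∀ {n} → ℕ → Vec ℕ n → Vec ℕ n
addColumn zero    v        = v
addColumn (suc k) []       = []
addColumn (suc k) (x ∷ xs) = suc x ∷ addColumn k xs

removeColumn : ∀ {n} → ℕ → Vec ℕ n → Vec ℕ n
removeColumn zero    v        = v
removeColumn (suc k) []       = []
removeColumn (suc k) (x ∷ xs) = pred x ∷ removeColumn k xs

-- λ_{k+1} = 0, i.e. at most k parts when v is a partition
AtMost : ∀ {n} → ℕ → Vec ℕ n → Set
AtMost k v = part v k ≡ 0

Positive : ∀ {n} → ℕ → Vec ℕ n → Set
Positive k v = ∀ {j} → j < k → 0 < part v j

Exactly : ∀ {n} → ℕ → Vec ℕ n → Set
Exactly k v = Positive k v × AtMost k v

atMost-length : ∀ {n} (v : Vec ℕ n) {j} → n ≤ j → AtMost j v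
atMost-length []      _         = refl
atMost-length (x ∷ v) (s≤s n≤j) = atMost-length v n≤j

part-addColumn-< : ∀ {k j n} (v : Vec ℕ n) → k ≤ n → j < k → part (addColumn k v) j ≡ suc (part v j)
part-addColumn-< {suc k} {zero}  (x ∷ v) _         _         = refl
part-addColumn-< {suc k} {suc j} (x ∷ v) (s≤s k≤n) (s≤s j<k) = part-addColumn-< v k≤n j<k

part-addColumn-≥ : ∀ {k j n} (v : Vec ℕ n) → k ≤ j → part (addColumn k v) j ≡ part v j
part-addColumn-≥ {zero}              v       _         = refl
part-addColumn-≥ {suc k}             []      _         = refl
part-addColumn-≥ {suc k} {suc j}     (x ∷ v) (s≤s k≤j) = part-addColumn-≥ v k≤j

part-removeColumn-< : ∀ {k j n} (v : Vec ℕ n) → j < k → part (removeColumn k v) j ≡ pred (part v j)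
part-removeColumn-< {suc k}          []      _         = refl
part-removeColumn-< {suc k} {zero}   (x ∷ v) _         = refl
part-removeColumn-< {suc k} {suc j}  (x ∷ v) (s≤s j<k) = part-removeColumn-< v j<k

part-removeColumn-≥ : ∀ {k j n} (v : Vec ℕ n) → k ≤ j → part (removeColumn k v) j ≡ part v j
part-removeColumn-≥ {zero}           v       _         = refl
part-removeColumn-≥ {suc k}          []      _         = refl
part-removeColumn-≥ {suc k} {suc j}  (x ∷ v) (s≤s k≤j) = part-removeColumn-≥ v k≤j

removeColumn-addColumn : ∀ {n} k (v : Vec ℕ n) → removeColumn k (addColumn k v) ≡ v
removeColumn-addColumn zero    v       = refl
removeColumn-addColumn (suc k) []      = refl
removeColumn-addColumn (suc k) (x ∷ v) = cong (x ∷_) (removeColumn-addColumn k v)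

addColumn-removeColumn : ∀ {n} k (v : Vec ℕ n) → Positive k v → addColumn k (removeColumn k v) ≡ v
addColumn-removeColumn zero    v           _   = refl
addColumn-removeColumn (suc k) []          _   = refl
addColumn-removeColumn (suc k) (zero ∷ v)  pos with () ← pos {0} (s≤s z≤n)
addColumn-removeColumn (suc k) (suc x ∷ v) pos = cong (suc x ∷_) (addColumn-removeColumn k v (λ j<k → pos (s≤s j<k)))

sum-addColumn : ∀ {n} k (v : Vec ℕ n) → k ≤ n → Vec.sum (addColumn k v) ≡ k ℕ.+ Vec.sum v
sum-addColumn zero    v       _         = refl
sum-addColumn (suc k) (x ∷ v) (s≤s k≤n) = cong suc (cong (x ℕ.+_) (sum-addColumn k v k≤n) ⟨ trans ⟩ swap x k (Vec.sum v))
  where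
  swap : ∀ x k s → x ℕ.+ (k ℕ.+ s) ≡ k ℕ.+ (x ℕ.+ s)
  swap = ℕSolver.solve-∀

addColumn-exactly : ∀ {n} k (v : Vec ℕ n) → k ≤ n → AtMost k v → Exactly k (addColumn k v)
addColumn-exactly k v k≤n atMost =
  (λ j<k → subst (0 <_) (sym (part-addColumn-< v k≤n j<k)) (s≤s z≤n)) ,
  (part-addColumn-≥ v ℕP.≤-refl ⟨ trans ⟩ atMost)

removeColumn-atMost : ∀ {n} k (v : Vec ℕ n) → AtMost k v → AtMost k (removeColumn k v)
removeColumn-atMost k v atMost = part-removeColumn-≥ v ℕP.≤-refl ⟨ trans ⟩ atMost

exactly-unique : ∀ {k l n} (v : Vec ℕ n) → Exactly k v → Exactly l v → k ≡ l
exactly-unique {k} {l} v (pos-k , zero-k) (pos-l , zero-l) with ℕP.<-cmp k l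
... | tri< k<l _ _ = ⊥-elim (ℕP.<⇒≢ (pos-l k<l) (sym zero-k))
... | tri≈ _ k≡l _ = k≡l
... | tri> _ _ l<k = ⊥-elim (ℕP.<⇒≢ (pos-k l<k) (sym zero-l))

numParts : ∀ {n} → Vec ℕ n → ℕ
numParts []          = 0
numParts (zero ∷ _)  = 0
numParts (suc _ ∷ v) = suc (numParts v)

numParts-exactly : ∀ {n} (v : Vec ℕ n) → Exactly (numParts v) v
numParts-exactly []          = (λ ()) , refl
numParts-exactly (zero ∷ v)  = (λ ()) , refl
numParts-exactly (suc x ∷ v) = positive , proj₂ (numParts-exactly v)
  where
  positive : Positive (suc (numParts v)) (suc x ∷ v)
  positive {zero}  _         = s≤s z≤n
  positive {suc j} (s≤s j<k) = proj₁ (numParts-exactly v) j<k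

numParts-≤ : ∀ {n k} (v : Vec ℕ n) → AtMost k v → numParts v ≤ k
numParts-≤ {k = k} v atMost = ℕP.≮⇒≥ λ k<numParts → ℕP.<⇒≢ (proj₁ (numParts-exactly v) k<numParts) (sym atMost)

part-antitone : ∀ {n j k} (v : Vec ℕ n) → IsPartition v → j ≤ k → part v k ≤ part v j
part-antitone {k = k} v isP j≤k with ℕP.m≤n⇒m<n∨m≡n j≤k
... | inj₂ refl = ℕP.≤-refl
part-antitone {k = suc k} v isP j≤k | inj₁ j<1+k = ℕP.≤-trans (isP k) (part-antitone v isP (ℕP.≤-pred j<1+k))

atMost-≤ : ∀ {n k j} (v : Vec ℕ n) → IsPartition v → AtMost k v → k ≤ j → AtMost j v
atMost-≤ v isP atMost k≤j = ℕP.n≤0⇒n≡0 (subst (part v _ ≤_) atMost (part-antitone v isP k≤j))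

atMost-zero : ∀ {n} (v : Vec ℕ n) → IsPartition v → AtMost 0 v → v ≡ replicate n 0
atMost-zero v isP atMost = go v (λ j → atMost-≤ v isP atMost z≤n)
  where
  go : ∀ {n} (v : Vec ℕ n) → (∀ j → part v j ≡ 0) → v ≡ replicate n 0
  go []      _      = refl
  go (x ∷ v) all-0 = cong₂ _∷_ (all-0 0) (go v (λ j → all-0 (suc j)))

addColumn-partition : ∀ {n k} (v : Vec ℕ n) → IsPartition v → AtMost k v → k ≤ n → IsPartition (addColumn k v)
addColumn-partition {k = k} v isP atMost k≤n j with suc j ℕ.<? k
... | yes 1+j<k rewrite part-addColumn-< v k≤n 1+j<k | part-addColumn-< v k≤n (ℕP.<-trans (ℕP.n<1+n j) 1+j<k) = s≤s (isP j)
... | no 1+j≮k rewrite part-addColumn-≥ v (ℕP.≮⇒≥ 1+j≮k) | atMost-≤ v isP atMost (ℕP.≮⇒≥ 1+j≮k) = z≤n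

removeColumn-partition : ∀ {n k} (v : Vec ℕ n) → IsPartition v → AtMost k v → IsPartition (removeColumn k v)
removeColumn-partition {k = k} v isP atMost j with suc j ℕ.<? k
... | yes 1+j<k rewrite part-removeColumn-< v 1+j<k | part-removeColumn-< v (ℕP.<-trans (ℕP.n<1+n j) 1+j<k) = ℕP.pred-mono-≤ (isP j)
... | no 1+j≮k rewrite part-removeColumn-≥ v (ℕP.≮⇒≥ 1+j≮k) | atMost-≤ v isP atMost (ℕP.≮⇒≥ 1+j≮k) = z≤n

Dominates₂ : ∀ {n} → Vec ℕ n → Vec ℕ n → Set
Dominates₂ a b = ∀ j → part b (j ℕ.+ 2) ≤ part a j

addColumn-dominates : ∀ {n p m} (a b : Vec ℕ n) → IsPartition b → AtMost m b → p ≤ n → m ≤ n → m ≤ 2 ℕ.+ p →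
  Dominates₂ a b → Dominates₂ (addColumn p a) (addColumn m b)
addColumn-dominates {p = p} {m} a b isP atMost p≤n m≤n m≤2+p dom j with j ℕ.+ 2 ℕ.<? m
... | yes j+2<m = subst₂ _≤_ (sym (part-addColumn-< b m≤n j+2<m)) (sym (part-addColumn-< a p≤n j<p)) (s≤s (dom j))
  where
  j<p : j < p
  j<p = ℕP.+-cancelˡ-< 2 j p (subst (_< 2 ℕ.+ p) (ℕP.+-comm j 2) (ℕP.<-≤-trans j+2<m m≤2+p))
... | no j+2≮m rewrite part-addColumn-≥ b (ℕP.≮⇒≥ j+2≮m) | atMost-≤ b isP atMost (ℕP.≮⇒≥ j+2≮m) = z≤n

removeColumn-dominates : ∀ {n p m} (a b : Vec ℕ n) → IsPartition b → AtMost m b →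
  Dominates₂ a b → Dominates₂ (removeColumn p a) (removeColumn m b)
removeColumn-dominates {p = p} {m} a b isP atMost dom j with j ℕ.+ 2 ℕ.<? m
... | yes j+2<m rewrite part-removeColumn-< b j+2<m = ℕP.≤-trans (ℕP.pred-mono-≤ (dom j)) pred≤removed
  where
  pred≤removed : pred (part a j) ≤ part (removeColumn p a) j
  pred≤removed with j ℕ.<? p
  ... | yes j<p rewrite part-removeColumn-< a j<p      = ℕP.≤-refl
  ... | no j≮p  rewrite part-removeColumn-≥ a (ℕP.≮⇒≥ j≮p) = ℕP.pred[n]≤n
... | no j+2≮m rewrite part-removeColumn-≥ b (ℕP.≮⇒≥ j+2≮m) | atMost-≤ b isP atMost (ℕP.≮⇒≥ j+2≮m) = z≤n

-- λ⁽¹⁾_{m+3} ≤ λ⁽²⁾_{m+1} = 0 when λ⁽²⁾ has at most m parts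
positive-dominated : ∀ {n p m} (a b : Vec ℕ n) → Positive p a → AtMost m b → Dominates₂ b a → p ≤ 2 ℕ.+ m
positive-dominated {p = p} {m} a b pos atMost dom = ℕP.≮⇒≥ λ 2+m<p →
  ℕP.<⇒≱ (pos (subst (_< p) (ℕP.+-comm 2 m) 2+m<p)) (subst (part a (m ℕ.+ 2) ≤_) atMost (dom m))

positive-≤ : ∀ {n k} (v : Vec ℕ n) → Positive k v → k ≤ n
positive-≤ {n} v pos = ℕP.≮⇒≥ λ n<k → ℕP.<⇒≢ (pos n<k) (sym (atMost-length v ℕP.≤-refl))

sum-removeColumn : ∀ {n} k (v : Vec ℕ n) → Positive k v → k ℕ.+ Vec.sum (removeColumn k v) ≡ Vec.sum v
sum-removeColumn k v pos =
  sym (sum-addColumn k (removeColumn k v) (positive-≤ v pos)) ⟨ trans ⟩ cong Vec.sum (addColumn-removeColumn k v pos)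

module Enumeration (n : ℕ) where

  CPair : Set
  CPair = Vec ℕ n × Vec ℕ n

  Bounded : ℕ → ℕ → ℕ → CPair → Set
  Bounded p m N (a , b) = IsCP22 (a , b) × size (a , b) ≡ N × AtMost p a × AtMost m b

  Shaped : ℕ → ℕ → ℕ → CPair → Set
  Shaped p m N (a , b) = IsCP22 (a , b) × size (a , b) ≡ N × Exactly p a × Exactly m b

  addColumns : ℕ → ℕ → CPair → CPair
  addColumns p m (a , b) = addColumn p a , addColumn m b

  removeColumns : ℕ → ℕ → CPair → CPair
  removeColumns p m (a , b) = removeColumn p a , removeColumn m b

  emptyPair : CPair
  emptyPair = replicate n 0 , replicate n 0

  shaped-bounded : ∀ {p m p′ m′ N} c → p′ ≤ p → m′ ≤ m → Shaped p′ m′ N c → Bounded p m N c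
  shaped-bounded (a , b) p′≤p m′≤m (cp@(isPa , isPb , _) , size≡ , (_ , atMost-a) , (_ , atMost-b)) =
    cp , size≡ , atMost-≤ a isPa atMost-a p′≤p , atMost-≤ b isPb atMost-b m′≤m

  shaped-admissible : ∀ {p m N} c → Shaped p m N c → Admissible p m
  shaped-admissible (a , b) ((_ , _ , b≼a , a≼b) , _ , (pos-a , atMost-a) , (pos-b , atMost-b)) =
    positive-dominated a b pos-a atMost-b a≼b , positive-dominated b a pos-b atMost-a b≼a

  addColumns-shaped : ∀ {p m N} d → p ≤ n → m ≤ n → Admissible p m → Bounded p m N d →
    Shaped p m (p ℕ.+ m ℕ.+ N) (addColumns p m d)
  addColumns-shaped {p} {m} (a , b) p≤n m≤n (p≤2+m , m≤2+p) ((isPa , isPb , b≼a , a≼b) , refl , atMost-a , atMost-b) =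
    (addColumn-partition a isPa atMost-a p≤n , addColumn-partition b isPb atMost-b m≤n ,
     addColumn-dominates a b isPb atMost-b p≤n m≤n m≤2+p b≼a , addColumn-dominates b a isPa atMost-a m≤n p≤n p≤2+m a≼b) ,
    size≡ , addColumn-exactly p a p≤n atMost-a , addColumn-exactly m b m≤n atMost-b
    where
    size≡ : Vec.sum (addColumn p a) ℕ.+ Vec.sum (addColumn m b) ≡ p ℕ.+ m ℕ.+ (Vec.sum a ℕ.+ Vec.sum b)
    size≡ rewrite sum-addColumn p a p≤n | sum-addColumn m b m≤n = interchange p (Vec.sum a) m (Vec.sum b)
      where
      interchange : ∀ p x m y → p ℕ.+ x ℕ.+ (m ℕ.+ y) ≡ p ℕ.+ m ℕ.+ (x ℕ.+ y)
      interchange = ℕSolver.solve-∀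

  removeColumns-bounded : ∀ {p m N} c → Shaped p m N c →
    p ℕ.+ m ℕ.+ size (removeColumns p m c) ≡ N × Bounded p m (size (removeColumns p m c)) (removeColumns p m c)
  removeColumns-bounded {p} {m} (a , b) ((isPa , isPb , b≼a , a≼b) , refl , (pos-a , atMost-a) , (pos-b , atMost-b)) =
    size≡ ,
    (removeColumn-partition a isPa atMost-a , removeColumn-partition b isPb atMost-b ,
     removeColumn-dominates {p = p} a b isPb atMost-b b≼a , removeColumn-dominates {p = m} b a isPa atMost-a a≼b) ,
    refl , removeColumn-atMost p a atMost-a , removeColumn-atMost m b atMost-b
    where
    interchange : ∀ p x m y → p ℕ.+ m ℕ.+ (x ℕ.+ y) ≡ p ℕ.+ x ℕ.+ (m ℕ.+ y)
    interchange = ℕSolver.solve-∀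
    size≡ : p ℕ.+ m ℕ.+ size (removeColumns p m (a , b)) ≡ Vec.sum a ℕ.+ Vec.sum b
    size≡ = interchange p _ m _ ⟨ trans ⟩ cong₂ ℕ._+_ (sum-removeColumn p a pos-a) (sum-removeColumn m b pos-b)

  addColumns-removeColumns : ∀ {p m N} c → Shaped p m N c → addColumns p m (removeColumns p m c) ≡ c
  addColumns-removeColumns (a , b) (_ , _ , (pos-a , _) , (pos-b , _)) =
    cong₂ _,_ (addColumn-removeColumn _ a pos-a) (addColumn-removeColumn _ b pos-b)

  addColumns-injective : ∀ p m {c d} → addColumns p m c ≡ addColumns p m d → c ≡ d
  addColumns-injective p m {a , b} {a′ , b′} eq = cong₂ _,_
    (sym (removeColumn-addColumn p a) ⟨ trans ⟩ cong (removeColumn p ∘ proj₁) eq ⟨ trans ⟩ removeColumn-addColumn p a′)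
    (sym (removeColumn-addColumn m b) ⟨ trans ⟩ cong (removeColumn m ∘ proj₂) eq ⟨ trans ⟩ removeColumn-addColumn m b′)

  emptyPair-shaped : Shaped 0 0 0 emptyPair
  emptyPair-shaped = (zeros-partition , zeros-partition , zeros-dominated , zeros-dominated) ,
    cong₂ ℕ._+_ (sum-zeros n) (sum-zeros n) , ((λ ()) , part-zeros n 0) , ((λ ()) , part-zeros n 0)
    where
    part-zeros : ∀ k j → part (replicate k 0) j ≡ 0
    part-zeros zero    j       = refl
    part-zeros (suc k) zero    = refl
    part-zeros (suc k) (suc j) = part-zeros k j
    sum-zeros : ∀ k → Vec.sum (replicate k 0) ≡ 0
    sum-zeros zero    = refl
    sum-zeros (suc k) = sum-zeros k
    zeros-partition : IsPartition (replicate n 0)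
    zeros-partition j = ℕP.≤-reflexive (part-zeros n (suc j) ⟨ trans ⟩ sym (part-zeros n j))
    zeros-dominated : Dominates₂ (replicate n 0) (replicate n 0)
    zeros-dominated j = ℕP.≤-reflexive (part-zeros n (j ℕ.+ 2) ⟨ trans ⟩ sym (part-zeros n j))

  shaped-empty : ∀ {N} c → Shaped 0 0 N c → c ≡ emptyPair × N ≡ 0
  shaped-empty (a , b) ((isPa , isPb , _) , refl , (_ , atMost-a) , (_ , atMost-b))
    rewrite atMost-zero a isPa atMost-a | atMost-zero b isPb atMost-b = refl , proj₁ (proj₂ emptyPair-shaped)

  -- For N ≤ f, exact f p m N lists the pairs of size N with exactly p and m parts; for (p, m) ≠ (0, 0)
  -- these are the pairs of size N - p - m with at most p and m parts, with a first column added.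
  -- The fuel f only serves termination: every step lowers the size.
  mutual
    exact : ℕ → ℕ → ℕ → ℕ → List CPair
    exact f zero    zero    zero    = emptyPair ∷ []
    exact f zero    zero    (suc N) = []
    exact f zero    (suc m) N       = peeled f zero (suc m) N
    exact f (suc p) m       N       = peeled f (suc p) m N

    peeled : ℕ → ℕ → ℕ → ℕ → List CPair
    peeled zero    p m N = []
    peeled (suc f) p m N with admissible? p m | p ℕ.+ m ℕ.≤? N
    ... | yes _ | yes _ = map (addColumns p m) (bounded f p m (N ∸ (p ℕ.+ m)))
    ... | _     | _     = []

    bounded : ℕ → ℕ → ℕ → ℕ → List CPair
    bounded f p m N = concatUpTo p λ p′ → concatUpTo m λ m′ → exact f p′ m′ N

  ∈-bounded⁻ : ∀ {f p m N c} → c ∈ bounded f p m N → ∃₂ λ p′ m′ → p′ ≤ p × m′ ≤ m × c ∈ exact f p′ m′ N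
  ∈-bounded⁻ {f} {p} {m} {N} c∈ =
    let p′ , p′≤p , c∈row = ∈-concatUpTo⁻ (λ p′ → concatUpTo m λ m′ → exact f p′ m′ N) c∈
        m′ , m′≤m , c∈exact = ∈-concatUpTo⁻ (λ m′ → exact f p′ m′ N) c∈row
    in p′ , m′ , p′≤p , m′≤m , c∈exact

  ∈-bounded⁺ : ∀ {f p m p′ m′ N c} → p′ ≤ p → m′ ≤ m → c ∈ exact f p′ m′ N → c ∈ bounded f p m N
  ∈-bounded⁺ {f} {p} {m} {p′} {N = N} p′≤p m′≤m c∈ =
    ∈-concatUpTo⁺ (λ p′ → concatUpTo m λ m′ → exact f p′ m′ N) p′≤p
                  (∈-concatUpTo⁺ (λ m′ → exact f p′ m′ N) m′≤m c∈)

  mutual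
    exact-sound : ∀ f p m N → p ≤ n → m ≤ n → ∀ {c} → c ∈ exact f p m N → Shaped p m N c
    exact-sound f zero    zero    zero    _   _   (here refl) = emptyPair-shaped
    exact-sound f zero    (suc m) N       p≤n m≤n c∈          = peeled-sound f zero (suc m) N p≤n m≤n c∈
    exact-sound f (suc p) m       N       p≤n m≤n c∈          = peeled-sound f (suc p) m N p≤n m≤n c∈

    peeled-sound : ∀ f p m N → p ≤ n → m ≤ n → ∀ {c} → c ∈ peeled f p m N → Shaped p m N c
    peeled-sound (suc f) p m N p≤n m≤n c∈ with admissible? p m | p ℕ.+ m ℕ.≤? N
    ... | yes adm | yes p+m≤N with ∈-map⁻ (addColumns p m) c∈
    ...   | d , d∈ , refl = subst (λ N → Shaped p m N (addColumns p m d)) (ℕP.m+[n∸m]≡n p+m≤N)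
                              (addColumns-shaped d p≤n m≤n adm (bounded-sound f p m (N ∸ (p ℕ.+ m)) p≤n m≤n d∈))

    bounded-sound : ∀ f p m N → p ≤ n → m ≤ n → ∀ {c} → c ∈ bounded f p m N → Bounded p m N c
    bounded-sound f p m N p≤n m≤n {c} c∈ =
      let p′ , m′ , p′≤p , m′≤m , c∈exact = ∈-bounded⁻ c∈
      in shaped-bounded c p′≤p m′≤m (exact-sound f p′ m′ N (ℕP.≤-trans p′≤p p≤n) (ℕP.≤-trans m′≤m m≤n) c∈exact)

  mutual
    exact-complete : ∀ f p m N → N ≤ f → ∀ c → Shaped p m N c → c ∈ exact f p m N
    exact-complete f zero zero N _ c shaped with shaped-empty c shaped
    ... | refl , refl = here refl
    exact-complete f zero    (suc m) N N≤f c shaped = peeled-complete f zero (suc m) N (s≤s z≤n) N≤f c shaped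
    exact-complete f (suc p) m       N N≤f c shaped = peeled-complete f (suc p) m N (s≤s z≤n) N≤f c shaped

    peeled-complete : ∀ f p m N → 1 ≤ p ℕ.+ m → N ≤ f → ∀ c → Shaped p m N c → c ∈ peeled f p m N
    peeled-complete f p m N 1≤p+m N≤f c shaped with removeColumns-bounded c shaped
    peeled-complete zero p m N 1≤p+m N≤f c shaped | size≡ , _ =
      ⊥-elim (ℕP.<⇒≱ (ℕP.<-≤-trans 1≤p+m (subst (p ℕ.+ m ≤_) size≡ (ℕP.m≤m+n (p ℕ.+ m) _))) N≤f)
    peeled-complete (suc f) p m N 1≤p+m N≤f c shaped | size≡ , bounded-c′ with admissible? p m | p ℕ.+ m ℕ.≤? N
    ... | no ¬adm | _         = ⊥-elim (¬adm (shaped-admissible c shaped))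
    ... | yes _   | no p+m≰N  = ⊥-elim (p+m≰N (subst (p ℕ.+ m ≤_) size≡ (ℕP.m≤m+n (p ℕ.+ m) _)))
    ... | yes _   | yes _     = subst (_∈ _) (addColumns-removeColumns c shaped)
      (∈-map⁺ (addColumns p m)
        (bounded-complete f p m (N ∸ (p ℕ.+ m)) fuel c′ (subst (λ N′ → Bounded p m N′ c′) N′≡ bounded-c′)))
      where
      c′ = removeColumns p m c
      N′≡ : size c′ ≡ N ∸ (p ℕ.+ m)
      N′≡ = sym (cong (_∸ (p ℕ.+ m)) (sym size≡) ⟨ trans ⟩ ℕP.m+n∸m≡n (p ℕ.+ m) (size c′))
      fuel : N ∸ (p ℕ.+ m) ≤ f
      fuel = ℕP.≤-trans (ℕP.∸-monoʳ-≤ N 1≤p+m) (ℕP.∸-monoˡ-≤ 1 N≤f)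

    bounded-complete : ∀ f p m N → N ≤ f → ∀ c → Bounded p m N c → c ∈ bounded f p m N
    bounded-complete f p m N N≤f (a , b) (cp , size≡ , atMost-a , atMost-b) =
      ∈-bounded⁺ (numParts-≤ a atMost-a) (numParts-≤ b atMost-b)
        (exact-complete f (numParts a) (numParts b) N N≤f (a , b) (cp , size≡ , numParts-exactly a , numParts-exactly b))

  mutual
    exact-unique : ∀ f p m N → p ≤ n → m ≤ n → Unique (exact f p m N)
    exact-unique f zero    zero    zero    _   _   = All.[] ∷ []
    exact-unique f zero    zero    (suc N) _   _   = []
    exact-unique f zero    (suc m) N       p≤n m≤n = peeled-unique f zero (suc m) N p≤n m≤n
    exact-unique f (suc p) m       N       p≤n m≤n = peeled-unique f (suc p) m N p≤n m≤n

    peeled-unique : ∀ f p m N → p ≤ n → m ≤ n → Unique (peeled f p m N)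
    peeled-unique zero    p m N _   _   = []
    peeled-unique (suc f) p m N p≤n m≤n with admissible? p m | p ℕ.+ m ℕ.≤? N
    ... | yes _ | yes _ = Unique.map⁺ (addColumns-injective p m) (bounded-unique f p m (N ∸ (p ℕ.+ m)) p≤n m≤n)
    ... | yes _ | no _  = []
    ... | no _  | _     = []

    bounded-unique : ∀ f p m N → p ≤ n → m ≤ n → Unique (bounded f p m N)
    bounded-unique f p m N p≤n m≤n = concatUpTo-unique p row
      (λ {p′} p′≤p → concatUpTo-unique m (λ m′ → exact f p′ m′ N)
        (λ m′≤m → exact-unique f p′ _ N (bound p′≤p p≤n) (bound m′≤m m≤n))
        (λ {m₁} {m₂} {c} m₁≤m m₂≤m c∈₁ c∈₂ → exactly-unique (proj₂ c)
           (shapeʳ c (exact-sound f p′ m₁ N (bound p′≤p p≤n) (bound m₁≤m m≤n) c∈₁))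
           (shapeʳ c (exact-sound f p′ m₂ N (bound p′≤p p≤n) (bound m₂≤m m≤n) c∈₂))))
      (λ {p₁} {p₂} {c} p₁≤p p₂≤p c∈₁ c∈₂ →
        let m₁ , m₁≤m , c∈exact₁ = ∈-concatUpTo⁻ (λ m′ → exact f p₁ m′ N) c∈₁
            m₂ , m₂≤m , c∈exact₂ = ∈-concatUpTo⁻ (λ m′ → exact f p₂ m′ N) c∈₂
        in exactly-unique (proj₁ c)
             (shapeˡ c (exact-sound f p₁ m₁ N (bound p₁≤p p≤n) (bound m₁≤m m≤n) c∈exact₁))
             (shapeˡ c (exact-sound f p₂ m₂ N (bound p₂≤p p≤n) (bound m₂≤m m≤n) c∈exact₂)))
      where
      row : ℕ → List CPair
      row p′ = concatUpTo m λ m′ → exact f p′ m′ N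
      bound = ℕP.≤-trans
      shapeˡ : ∀ {p m N} c → Shaped p m N c → Exactly p (proj₁ c)
      shapeˡ _ (_ , _ , exactlyˡ , _) = exactlyˡ
      shapeʳ : ∀ {p m N} c → Shaped p m N c → Exactly m (proj₂ c)
      shapeʳ _ (_ , _ , _ , exactlyʳ) = exactlyʳ

  exactGF-origin : exactGF 0 0 ≋ oneS
  exactGF-origin = ≋-trans (≋-sym Δ₂W-origin) (≋-trans (W-admissible (z≤n , z≤n)) Z-zero-zero)

  mutual
    exact-length : ∀ f p m N → N ≤ f → + length (exact f p m N) ≡ exactGF p m N
    exact-length f zero    zero    zero    _   = sym (exactGF-origin 0)
    exact-length f zero    zero    (suc N) _   = sym (exactGF-origin (suc N))
    exact-length f zero    (suc m) N       N≤f = peeled-length f zero (suc m) N (s≤s z≤n) N≤f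
    exact-length f (suc p) m       N       N≤f = peeled-length f (suc p) m N (s≤s z≤n) N≤f

    peeled-length : ∀ f p m N → 1 ≤ p ℕ.+ m → N ≤ f → + length (peeled f p m N) ≡ exactGF p m N
    peeled-length zero    p m N 1≤p+m N≤0 = sym (exactGF-below {p} {m} (ℕP.≤-<-trans N≤0 1≤p+m))
    peeled-length (suc f) p m N 1≤p+m N≤f with admissible? p m | p ℕ.+ m ℕ.≤? N
    ... | yes _ | yes p+m≤N = begin
      + length (map (addColumns p m) (bounded f p m (N ∸ (p ℕ.+ m))))
        ≡⟨ cong +_ (ListP.length-map (addColumns p m) (bounded f p m (N ∸ (p ℕ.+ m)))) ⟩
      + length (bounded f p m (N ∸ (p ℕ.+ m)))
        ≡⟨ bounded-length f p m (N ∸ (p ℕ.+ m)) fuel ⟩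
      W p m (N ∸ (p ℕ.+ m))
        ≡⟨ qPow-⊛-in (p ℕ.+ m) (W p m) N p+m≤N ⟨
      (qPow (p ℕ.+ m) ⊛ W p m) N
        ∎
      where
      open ≡-Reasoning
      fuel : N ∸ (p ℕ.+ m) ≤ f
      fuel = ℕP.≤-trans (ℕP.∸-monoʳ-≤ N 1≤p+m) (ℕP.∸-monoˡ-≤ 1 N≤f)
    ... | yes _ | no p+m≰N = sym (qPow-⊛-out (p ℕ.+ m) (W p m) N (ℕP.≰⇒> p+m≰N))
    ... | no _  | _        = refl

    bounded-length : ∀ f p m N → N ≤ f → + length (bounded f p m N) ≡ W p m N
    bounded-length f p m N N≤f = begin
      + length (bounded f p m N)
        ≡⟨ length-concatUpTo p (λ p′ → concatUpTo m (λ m′ → exact f p′ m′ N)) ⟩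
      sumUpTo p (λ p′ → + length (concatUpTo m (λ m′ → exact f p′ m′ N)))
        ≡⟨ sumUpTo-ext p (λ p′ → length-concatUpTo m (λ m′ → exact f p′ m′ N)) ⟩
      sumUpTo p (λ p′ → sumUpTo m (λ m′ → + length (exact f p′ m′ N)))
        ≡⟨ sumUpTo-ext p (λ p′ → sumUpTo-ext m λ m′ →
             exact-length f p′ m′ N N≤f ⟨ trans ⟩ sym (W-Δ₂ p′ m′ N)) ⟩
      sumUpTo p (λ p′ → sumUpTo m (λ m′ → Δ₂ W p′ m′ N))
        ≡⟨ sumUpTo-Δ₂ W p m N ⟩
      W p m N
        ∎
      where open ≡-Reasoning

theorem5p8 : (n N : ℕ) →
    Σ (List (Vec ℕ n × Vec ℕ n)) (λ L →
    Unique L ×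
    All (λ c → IsCP22 c × size c ≡ N) L ×
    (∀ c → IsCP22 c → size c ≡ N → c ∈ L) ×
    + length L ≡ rhs n N)
theorem5p8 n N =
  bounded N n n N ,
  bounded-unique N n n N ℕP.≤-refl ℕP.≤-refl ,
  All.tabulate (λ c∈ → let cp , size≡ , _ = bounded-sound N n n N ℕP.≤-refl ℕP.≤-refl c∈ in cp , size≡) ,
  (λ (a , b) cp size≡ → bounded-complete N n n N ℕP.≤-refl (a , b)
                          (cp , size≡ , atMost-length a ℕP.≤-refl , atMost-length b ℕP.≤-refl)) ,
  (bounded-length N n n N ℕP.≤-refl ⟨ trans ⟩ W-admissible (ℕP.m≤n+m n 2 , ℕP.m≤n+m n 2) N ⟨ trans ⟩ sym (rhs-Z n N))
  where open Enumeration n
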